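{- Let $I=\{i_1<i_2<\dots<i_l\}\subseteq\mathbb{Z}^+$ be a finite nonempty set with $m=i_l$. Then, as polynomials in $n$, \[ d(I,n+1)=d(I,n)+\sum_{i_t\in I''\setminus\{m\}}d(I_t,n)+\sum_{i_t\in I'\setminus\{m\}}d(\widehat{I}_t,n)+d(I^-,m-1)\binom{n}{m-1}. \]
   Context: For a finite set $J\subseteq\mathbb{Z}^+$ let $m(J)=\max(J\cup\{0\})$. For integers $n>m(J)$, $d(J,n)$ is the number of permutations $\pi$ of $[n]$ whose descent set $\{i\in[n-1]:\pi_i>\pi_{i+1}\}$ equals $J$; there is a unique polynomial in $n$ of degree $m(J)$ agreeing with this count for all integers $n>m(J)$, and $d(J,n)$ denotes this polynomial (so it may be evaluated at any number). For $I=\{i_1<\dots<i_l\}$ nonempty and $1\le t\le l$: $I^-=I\setminus\{i_l\}$; $I_t=\{i_1,\dots,i_{t-1},i_t-1,\dots,i_l-1\}\setminus\{0\}$; $\widehat{I}_t=\{i_1,\dots,i_{t-1},i_{t+1}-1,\dots,i_l-1\}$; $I'=\{i_j\in I: i_j-1\notin I\}$; $I''=I'\setminus\{1\}$. The binomial coefficient is $\binom{w}{k}=w(w-1)\cdots(w-k+1)/k!$. -}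

module Defs where

open import Data.Nat using (ℕ; zero; suc; _∸_; _⊔_; _<_; _≤_; _≡ᵇ_; _<ᵇ_)
open import Data.Bool using (Bool; true; false; not; _∧_; if_then_else_)
open import Data.Bool.ListAction using (any; all)
open import Data.List using (List; []; _∷_; [_]; _++_; map; concatMap; upTo; foldr; filterᵇ; take; drop; zip; length)
open import Data.List.Relation.Unary.All using (All)
open import Data.Product using (Σ; _×_)
open import Data.Integer using (+_)
open import Data.Rational using (ℚ; _/_; _+_; _-_; _*_; 0ℚ; 1ℚ)
open import Relation.Binary.PropositionalEquality using (_≡_)

-- Finite sets of positive integers are represented by lists of ℕ
-- (read as sets: only membership matters).

_∈ᵇ_ : ℕ → List ℕ → Bool
x ∈ᵇ xs = any (λ y → x ≡ᵇ y) xs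

sameSet : List ℕ → List ℕ → Bool
sameSet A B = all (λ a → a ∈ᵇ B) A ∧ all (λ b → b ∈ᵇ A) B

mx : List ℕ → ℕ
mx = foldr _⊔_ 0

words : ℕ → ℕ → List (List ℕ)
words n zero = [ [] ]
words n (suc k) = concatMap (λ x → map (x ∷_) (words n k)) (upTo n)

distinct : List ℕ → Bool
distinct [] = true
distinct (x ∷ xs) = not (x ∈ᵇ xs) ∧ distinct xs

-- permutations of {0,…,n-1} (order-isomorphic to permutations of [n])
perms : ℕ → List (List ℕ)
perms n = filterᵇ distinct (words n n)

descentsFrom : ℕ → List ℕ → List ℕ
descentsFrom i (x ∷ y ∷ xs) =
  (if y <ᵇ x then [ i ] else []) ++ descentsFrom (suc i) (y ∷ xs)
descentsFrom i _ = []

-- descent set {i ∈ [n-1] : π_i > π_{i+1}} (1-based positions)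
descentSet : List ℕ → List ℕ
descentSet π = descentsFrom 1 π

countᵇ : {A : Set} → (A → Bool) → List A → ℕ
countᵇ p [] = 0
countᵇ p (x ∷ xs) = if p x then suc (countᵇ p xs) else countᵇ p xs

dcount : List ℕ → ℕ → ℕ
dcount J n = countᵇ (λ π → sameSet (descentSet π) J) (perms n)

ℕtoℚ : ℕ → ℚ
ℕtoℚ k = + k / 1

evalPoly : List ℚ → ℚ → ℚ
evalPoly [] x = 0ℚ
evalPoly (c ∷ cs) x = c + x * evalPoly cs x

-- binom w k = w (w-1) ⋯ (w-k+1) / k!
binom : ℚ → ℕ → ℚ
binom w zero = 1ℚ
binom w (suc k) = binom w k * ((w - ℕtoℚ k) * (+ 1 / suc k))

-- D is "the" polynomial d(J,·): for every finite J ⊆ ℤ⁺, D J is a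
-- polynomial (of degree ≤ m(J)) agreeing with the count for all n > m(J).
IsDescentPoly : (List ℕ → ℚ → ℚ) → Set
IsDescentPoly D =
  (J : List ℕ) → All (λ j → 0 < j) J →
    Σ (List ℚ) (λ cs →
      (length cs ≤ suc (mx J)) ×
      ((x : ℚ) → D J x ≡ evalPoly cs x) ×
      ((n : ℕ) → mx J < n → D J (ℕtoℚ n) ≡ ℕtoℚ (dcount J n)))

-- Set operations on I = [i₁ < … < i_l] (given as a strictly increasing
-- list).  Indices s are 0-based: s = t - 1.

sumℚ : List ℚ → ℚ
sumℚ = foldr _+_ 0ℚ

initL : List ℕ → List ℕ
initL [] = []
initL (x ∷ []) = []
initL (x ∷ y ∷ xs) = x ∷ initL (y ∷ xs)

Ist : List ℕ → ℕ → List ℕ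
Ist I s = take s I ++ filterᵇ (λ x → not (x ≡ᵇ 0)) (map (λ x → x ∸ 1) (drop s I))

Ihat : List ℕ → ℕ → List ℕ
Ihat I s = take s I ++ map (λ x → x ∸ 1) (drop (suc s) I)

Iprime : List ℕ → List ℕ
Iprime I = filterᵇ (λ x → not ((x ∸ 1) ∈ᵇ I)) I

Idprime : List ℕ → List ℕ
Idprime I = filterᵇ (λ x → not (x ≡ᵇ 1)) (Iprime I)

enum : List ℕ → List (Σ ℕ (λ _ → ℕ))
enum I = zip (upTo (length I)) I

-- Strategy.  Everything is first proved for the counts d(J, n) at naturals
-- and then transferred to the polynomials D J by rigidity (two polynomials
-- agreeing at all large naturals are equal).
module Submission where

module NatCast where
  open import Defs
  open import Data.Nat as ℕ using (zero; suc)
  import Data.Nat.Properties as ℕP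
  import Data.Nat.Coprimality as Coprime
  open import Data.Integer using (+_)
  import Data.Integer as ℤ
  import Data.Integer.Properties as ℤP
  import Data.Rational as ℚ
  open import Data.Rational using (ℚ; mkℚ; _/_; ≢-nonZero; _+_; _*_; 0ℚ; 1ℚ; 1/_; NonZero)
  open import Data.Rational.Properties
  open import Data.Rational.Solver using (module +-*-Solver)
  open +-*-Solver
  open import Relation.Binary.PropositionalEquality
  open ≡-Reasoning

  ℕtoℚ≡mkℚ : ∀ k → ℕtoℚ k ≡ mkℚ (+ k) 0 (Coprime.sym (Coprime.1-coprimeTo k))
  ℕtoℚ≡mkℚ k = normalize-coprime (Coprime.sym (Coprime.1-coprimeTo k))

  ℕtoℚ-suc : ∀ k → ℕtoℚ (suc k) ≡ ℕtoℚ k + 1ℚ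
  ℕtoℚ-suc k rewrite ℕtoℚ≡mkℚ k = /-cong numerators refl
    where
    numerators : + suc k ≡ + k ℤ.* + 1 ℤ.+ + 1 ℤ.* + 1
    numerators = trans (cong +_ (trans (ℕP.+-comm 1 k) (cong (ℕ._+ 1) (sym (ℕP.*-identityʳ k)))))
                       (cong (ℤ._+ + 1) (sym (ℤP.+◃n≡+n (k ℕ.* 1))))

  ℕtoℚ-+ : ∀ a b → ℕtoℚ (a ℕ.+ b) ≡ ℕtoℚ a + ℕtoℚ b
  ℕtoℚ-+ zero b = sym (+-identityˡ (ℕtoℚ b))
  ℕtoℚ-+ (suc a) b = begin
    ℕtoℚ (suc (a ℕ.+ b))  ≡⟨ ℕtoℚ-suc (a ℕ.+ b) ⟩
    ℕtoℚ (a ℕ.+ b) + 1ℚ   ≡⟨ cong (_+ 1ℚ) (ℕtoℚ-+ a b) ⟩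
    ℕtoℚ a + ℕtoℚ b + 1ℚ  ≡⟨ solve 2 (λ x y → x :+ y :+ con 1ℚ := x :+ con 1ℚ :+ y) refl (ℕtoℚ a) (ℕtoℚ b) ⟩
    ℕtoℚ a + 1ℚ + ℕtoℚ b  ≡⟨ cong (_+ ℕtoℚ b) (sym (ℕtoℚ-suc a)) ⟩
    ℕtoℚ (suc a) + ℕtoℚ b ∎

  ℕtoℚ-* : ∀ a b → ℕtoℚ (a ℕ.* b) ≡ ℕtoℚ a * ℕtoℚ b
  ℕtoℚ-* zero b = sym (*-zeroˡ (ℕtoℚ b))
  ℕtoℚ-* (suc a) b = begin
    ℕtoℚ (b ℕ.+ a ℕ.* b)      ≡⟨ ℕtoℚ-+ b (a ℕ.* b) ⟩
    ℕtoℚ b + ℕtoℚ (a ℕ.* b)   ≡⟨ cong (λ t → ℕtoℚ b + t) (ℕtoℚ-* a b) ⟩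
    ℕtoℚ b + ℕtoℚ a * ℕtoℚ b  ≡⟨ solve 2 (λ x y → y :+ x :* y := (x :+ con 1ℚ) :* y) refl (ℕtoℚ a) (ℕtoℚ b) ⟩
    (ℕtoℚ a + 1ℚ) * ℕtoℚ b    ≡⟨ cong (_* ℕtoℚ b) (sym (ℕtoℚ-suc a)) ⟩
    ℕtoℚ (suc a) * ℕtoℚ b     ∎

  ℕtoℚ-suc≢0 : ∀ k → ℕtoℚ (suc k) ≢ 0ℚ
  ℕtoℚ-suc≢0 k eq with cong ℚ.numerator (trans (sym (ℕtoℚ≡mkℚ (suc k))) eq)
  ... | ()

  ℕtoℚ-suc*inverse : ∀ k → ℕtoℚ (suc k) * (+ 1 / suc k) ≡ 1ℚ
  ℕtoℚ-suc*inverse k =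
    trans (cong₂ _*_ (ℕtoℚ≡mkℚ (suc k)) (normalize-coprime {1} {k} (Coprime.1-coprimeTo (suc k))))
          (*-inverseʳ (mkℚ (+ suc k) 0 (Coprime.sym (Coprime.1-coprimeTo (suc k)))))

  ℕtoℚ-suc-cancel : ∀ k y → ℕtoℚ (suc k) * y ≡ 0ℚ → y ≡ 0ℚ
  ℕtoℚ-suc-cancel k y eq = begin
    y                 ≡⟨ sym (*-identityˡ y) ⟩
    1ℚ * y            ≡⟨ cong (_* y) (sym (*-inverseˡ x)) ⟩
    (1/ x) * x * y    ≡⟨ *-assoc (1/ x) x y ⟩
    (1/ x) * (x * y)  ≡⟨ cong (λ t → (1/ x) * t) eq ⟩
    (1/ x) * 0ℚ       ≡⟨ *-zeroʳ (1/ x) ⟩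
    0ℚ                ∎
    where
    x : ℚ
    x = ℕtoℚ (suc k)
    instance
      x≢0 : NonZero x
      x≢0 = ≢-nonZero (ℕtoℚ-suc≢0 k)

-- Rigidity is what lets us prove identities
-- between the polynomials d(J,·) by checking them on large integers only.
module Polynomials where
  open import Defs
  open NatCast
  open import Data.Nat as ℕ using (zero; suc)
  import Data.Nat.Properties as ℕP
  open import Data.Bool using (Bool; true; false; if_then_else_)
  open import Data.List using (List; []; _∷_; length; map)
  open import Data.List.Relation.Unary.All using (All; []; _∷_)
  open import Data.Product using (Σ; _,_; proj₁; proj₂)
  open import Data.Rational using (ℚ; _+_; _-_; _*_; -_; 0ℚ; 1ℚ)
  open import Data.Rational.Properties
  open import Data.Rational.Solver using (module +-*-Solver)
  open +-*-Solver
  open import Relation.Binary.PropositionalEquality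
  open ≡-Reasoning

  padd : List ℚ → List ℚ → List ℚ
  padd [] q = q
  padd (a ∷ p) [] = a ∷ p
  padd (a ∷ p) (b ∷ q) = (a + b) ∷ padd p q

  eval-padd : ∀ p q x → evalPoly (padd p q) x ≡ evalPoly p x + evalPoly q x
  eval-padd [] q x = sym (+-identityˡ _)
  eval-padd (a ∷ p) [] x = sym (+-identityʳ _)
  eval-padd (a ∷ p) (b ∷ q) x = begin
    a + b + x * evalPoly (padd p q) x ≡⟨ cong (λ t → a + b + x * t) (eval-padd p q x) ⟩
    a + b + x * (evalPoly p x + evalPoly q x) ≡⟨ solve 5 (λ a b x P Q → a :+ b :+ x :* (P :+ Q) := a :+ x :* P :+ (b :+ x :* Q)) refl a b x (evalPoly p x) (evalPoly q x) ⟩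
    a + x * evalPoly p x + (b + x * evalPoly q x) ∎

  pscale : ℚ → List ℚ → List ℚ
  pscale c [] = []
  pscale c (a ∷ p) = c * a ∷ pscale c p

  eval-pscale : ∀ c p x → evalPoly (pscale c p) x ≡ c * evalPoly p x
  eval-pscale c [] x = sym (*-zeroʳ c)
  eval-pscale c (a ∷ p) x = begin
    c * a + x * evalPoly (pscale c p) x ≡⟨ cong (λ t → c * a + x * t) (eval-pscale c p x) ⟩
    c * a + x * (c * evalPoly p x) ≡⟨ solve 4 (λ c a x P → c :* a :+ x :* (c :* P) := c :* (a :+ x :* P)) refl c a x (evalPoly p x) ⟩
    c * (a + x * evalPoly p x) ∎

  pmul : List ℚ → List ℚ → List ℚ
  pmul [] q = []
  pmul (a ∷ p) q = padd (pscale a q) (0ℚ ∷ pmul p q)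

  eval-pmul : ∀ p q x → evalPoly (pmul p q) x ≡ evalPoly p x * evalPoly q x
  eval-pmul [] q x = sym (*-zeroˡ (evalPoly q x))
  eval-pmul (a ∷ p) q x = begin
    evalPoly (padd (pscale a q) (0ℚ ∷ pmul p q)) x ≡⟨ eval-padd (pscale a q) (0ℚ ∷ pmul p q) x ⟩
    evalPoly (pscale a q) x + (0ℚ + x * evalPoly (pmul p q) x) ≡⟨ cong₂ (λ s t → s + (0ℚ + x * t)) (eval-pscale a q x) (eval-pmul p q x) ⟩
    a * evalPoly q x + (0ℚ + x * (evalPoly p x * evalPoly q x)) ≡⟨ solve 4 (λ a x P Q → a :* Q :+ (con 0ℚ :+ x :* (P :* Q)) := (a :+ x :* P) :* Q) refl a x (evalPoly p x) (evalPoly q x) ⟩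
    (a + x * evalPoly p x) * evalPoly q x ∎

  pshift : List ℚ → List ℚ
  pshift [] = []
  pshift (c ∷ cs) = padd (c ∷ []) (pmul (1ℚ ∷ 1ℚ ∷ []) (pshift cs))

  eval-pshift : ∀ p x → evalPoly (pshift p) x ≡ evalPoly p (x + 1ℚ)
  eval-pshift [] x = refl
  eval-pshift (c ∷ cs) x = begin
    evalPoly (padd (c ∷ []) (pmul (1ℚ ∷ 1ℚ ∷ []) (pshift cs))) x ≡⟨ eval-padd (c ∷ []) (pmul (1ℚ ∷ 1ℚ ∷ []) (pshift cs)) x ⟩
    (c + x * 0ℚ) + evalPoly (pmul (1ℚ ∷ 1ℚ ∷ []) (pshift cs)) x ≡⟨ cong (λ t → (c + x * 0ℚ) + t) (eval-pmul (1ℚ ∷ 1ℚ ∷ []) (pshift cs) x) ⟩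
    (c + x * 0ℚ) + (1ℚ + x * (1ℚ + x * 0ℚ)) * evalPoly (pshift cs) x ≡⟨ cong (λ t → (c + x * 0ℚ) + (1ℚ + x * (1ℚ + x * 0ℚ)) * t) (eval-pshift cs x) ⟩
    (c + x * 0ℚ) + (1ℚ + x * (1ℚ + x * 0ℚ)) * evalPoly cs (x + 1ℚ) ≡⟨ solve 3 (λ c x P → (c :+ x :* con 0ℚ) :+ (con 1ℚ :+ x :* (con 1ℚ :+ x :* con 0ℚ)) :* P := c :+ (x :+ con 1ℚ) :* P) refl c x (evalPoly cs (x + 1ℚ)) ⟩
    c + (x + 1ℚ) * evalPoly cs (x + 1ℚ) ∎

  IsPoly : (ℚ → ℚ) → Set
  IsPoly f = Σ (List ℚ) (λ cs → ∀ x → f x ≡ evalPoly cs x)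

  poly-const : ∀ c → IsPoly (λ _ → c)
  poly-const c = (c ∷ []) , λ x → solve 2 (λ c x → c := c :+ x :* con 0ℚ) refl c x

  poly-id : IsPoly (λ x → x)
  poly-id = (0ℚ ∷ 1ℚ ∷ []) , λ x → solve 1 (λ x → x := con 0ℚ :+ x :* (con 1ℚ :+ x :* con 0ℚ)) refl x

  poly-+ : ∀ {f g} → IsPoly f → IsPoly g → IsPoly (λ x → f x + g x)
  poly-+ (p , hp) (q , hq) = padd p q , λ x → trans (cong₂ _+_ (hp x) (hq x)) (sym (eval-padd p q x))

  poly-* : ∀ {f g} → IsPoly f → IsPoly g → IsPoly (λ x → f x * g x)
  poly-* (p , hp) (q , hq) = pmul p q , λ x → trans (cong₂ _*_ (hp x) (hq x)) (sym (eval-pmul p q x))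

  poly-shift : ∀ {f} → IsPoly f → IsPoly (λ x → f (x + 1ℚ))
  poly-shift (p , hp) = pshift p , λ x → trans (hp (x + 1ℚ)) (sym (eval-pshift p x))

  poly-ext : ∀ {f g} → (∀ x → f x ≡ g x) → IsPoly f → IsPoly g
  poly-ext e (p , hp) = p , λ x → trans (sym (e x)) (hp x)

  poly-- : ∀ {f g} → IsPoly f → IsPoly g → IsPoly (λ x → f x - g x)
  poly-- {f} {g} pf pg = poly-ext (λ x → solve 2 (λ a b → a :+ con (- 1ℚ) :* b := a :- b) refl (f x) (g x))
    (poly-+ pf (poly-* (poly-const (- 1ℚ)) pg))

  poly-sum : {A : Set} (L : List A) (F : A → ℚ → ℚ) → All (λ e → IsPoly (F e)) L →
             IsPoly (λ x → sumℚ (map (λ e → F e x) L))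
  poly-sum [] F [] = poly-const 0ℚ
  poly-sum (e ∷ L) F (p ∷ ps) = poly-+ p (poly-sum L F ps)

  poly-if : ∀ (b : Bool) {f : ℚ → ℚ} → IsPoly f → IsPoly (λ x → if b then f x else 0ℚ)
  poly-if true p = p
  poly-if false p = poly-const 0ℚ

  pdiv : List ℚ → ℚ → List ℚ
  pdiv [] a = []
  pdiv (c ∷ []) a = []
  pdiv (c ∷ c' ∷ cs) a = evalPoly (c' ∷ cs) a ∷ pdiv (c' ∷ cs) a

  eval-pdiv : ∀ p a x → evalPoly p x ≡ (x - a) * evalPoly (pdiv p a) x + evalPoly p a
  eval-pdiv [] a x = solve 2 (λ x a → con 0ℚ := (x :- a) :* con 0ℚ :+ con 0ℚ) refl x a
  eval-pdiv (c ∷ []) a x = solve 3 (λ c x a → c :+ x :* con 0ℚ := (x :- a) :* con 0ℚ :+ (c :+ a :* con 0ℚ)) refl c x a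
  eval-pdiv (c ∷ c' ∷ cs) a x = begin
    c + x * evalPoly (c' ∷ cs) x ≡⟨ cong (λ t → c + x * t) (eval-pdiv (c' ∷ cs) a x) ⟩
    c + x * ((x - a) * q + r) ≡⟨ solve 5 (λ c x a q r → c :+ x :* ((x :- a) :* q :+ r) := (x :- a) :* (r :+ x :* q) :+ (c :+ a :* r)) refl c x a q r ⟩
    (x - a) * (r + x * q) + (c + a * r) ∎
    where
    q r : ℚ
    q = evalPoly (pdiv (c' ∷ cs) a) x
    r = evalPoly (c' ∷ cs) a

  length-pdiv : ∀ p a k → length p ℕ.≤ suc k → length (pdiv p a) ℕ.≤ k
  length-pdiv [] a k le = ℕ.z≤n
  length-pdiv (c ∷ []) a k le = ℕ.z≤n
  length-pdiv (c ∷ c' ∷ cs) a (suc k) (ℕ.s≤s le) = ℕ.s≤s (length-pdiv (c' ∷ cs) a k le)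

  -- A coefficient list of length ≤ k vanishing at N, N+1, N+2, … is zero
  -- everywhere: divide by (x - N) and note that the quotient vanishes at
  -- N+1, N+2, … (the cast of a positive natural can be cancelled).
  vanishing-tail⇒zero : ∀ k p → length p ℕ.≤ k → ∀ N →
                        (∀ j → evalPoly p (ℕtoℚ (N ℕ.+ j)) ≡ 0ℚ) → ∀ x → evalPoly p x ≡ 0ℚ
  vanishing-tail⇒zero zero [] le N h x = refl
  vanishing-tail⇒zero (suc k) p le N h x = begin
    evalPoly p x                        ≡⟨ eval-pdiv p a x ⟩
    (x - a) * evalPoly q x + evalPoly p a ≡⟨ cong₂ (λ s t → (x - a) * s + t) (vanishing-tail⇒zero k q (length-pdiv p a k le) (suc N) q-vanishes x) p-at-N ⟩
    (x - a) * 0ℚ + 0ℚ                   ≡⟨ solve 2 (λ x a → (x :- a) :* con 0ℚ :+ con 0ℚ := con 0ℚ) refl x a ⟩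
    0ℚ                                  ∎
    where
    a : ℚ
    a = ℕtoℚ N
    q : List ℚ
    q = pdiv p a
    p-at-N : evalPoly p a ≡ 0ℚ
    p-at-N = trans (cong (λ t → evalPoly p (ℕtoℚ t)) (sym (ℕP.+-identityʳ N))) (h 0)
    q-vanishes : ∀ j → evalPoly q (ℕtoℚ (suc N ℕ.+ j)) ≡ 0ℚ
    q-vanishes j = ℕtoℚ-suc-cancel j _ (begin
        ℕtoℚ (suc j) * evalPoly q y               ≡⟨ cong (_* evalPoly q y) gap ⟩
        (y - a) * evalPoly q y                    ≡⟨ solve 2 (λ A B → A := A :+ B :- B) refl ((y - a) * evalPoly q y) (evalPoly p a) ⟩
        (y - a) * evalPoly q y + evalPoly p a - evalPoly p a ≡⟨ cong (_- evalPoly p a) (sym (eval-pdiv p a y)) ⟩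
        evalPoly p y - evalPoly p a               ≡⟨ cong₂ _-_ (trans (cong (λ t → evalPoly p (ℕtoℚ t)) (sym (ℕP.+-suc N j))) (h (suc j))) p-at-N ⟩
        0ℚ - 0ℚ                                   ≡⟨⟩
        0ℚ                                        ∎)
      where
      y : ℚ
      y = ℕtoℚ (suc N ℕ.+ j)
      gap : ℕtoℚ (suc j) ≡ y - a
      gap = begin
        ℕtoℚ (suc j)              ≡⟨ solve 2 (λ A B → A := B :+ A :- B) refl (ℕtoℚ (suc j)) a ⟩
        a + ℕtoℚ (suc j) - a      ≡⟨ cong (_- a) (sym (ℕtoℚ-+ N (suc j))) ⟩
        ℕtoℚ (N ℕ.+ suc j) - a    ≡⟨ cong (λ t → ℕtoℚ t - a) (ℕP.+-suc N j) ⟩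
        y - a                     ∎

  poly-rigidity : ∀ {f g} → IsPoly f → IsPoly g → ∀ N →
                  (∀ n → N ℕ.≤ n → f (ℕtoℚ n) ≡ g (ℕtoℚ n)) → ∀ x → f x ≡ g x
  poly-rigidity {f} {g} pf pg N agree x =
    difference-zero (trans (eval-diff x) (vanishing-tail⇒zero (length cs) cs ℕP.≤-refl N diff-vanishes x))
    where
    cs : List ℚ
    cs = proj₁ (poly-- pf pg)
    eval-diff : ∀ x → f x - g x ≡ evalPoly cs x
    eval-diff = proj₂ (poly-- pf pg)
    diff-vanishes : ∀ j → evalPoly cs (ℕtoℚ (N ℕ.+ j)) ≡ 0ℚ
    diff-vanishes j = trans (sym (eval-diff _))
      (trans (cong (_- g (ℕtoℚ (N ℕ.+ j))) (agree (N ℕ.+ j) (ℕP.m≤m+n N j))) (+-inverseʳ (g (ℕtoℚ (N ℕ.+ j)))))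
    difference-zero : f x - g x ≡ 0ℚ → f x ≡ g x
    difference-zero e = begin
      f x                 ≡⟨ solve 2 (λ p q → p := (p :- q) :+ q) refl (f x) (g x) ⟩
      (f x - g x) + g x   ≡⟨ cong (_+ g x) e ⟩
      0ℚ + g x            ≡⟨ +-identityˡ (g x) ⟩
      g x                 ∎

module BoolSets where
  open import Defs
  open import Data.Nat using (ℕ; zero; suc; pred; _+_; _<_; _≤_; z≤n; s≤s; _≡ᵇ_; _<ᵇ_; _≤ᵇ_)
  import Data.Nat.Properties as ℕP
  open import Data.Bool using (T; Bool; true; false; not; _∧_; _∨_)
  open import Data.Bool.Properties using (∨-identityʳ; ∧-zeroʳ; ∨-zeroʳ)
  open import Data.Bool.ListAction using (all)
  open import Data.List using ([]; _∷_; [_]; _++_; map; filterᵇ)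
  open import Data.List.Relation.Unary.All using (All; []; _∷_)
  open import Data.Product using (Σ; _,_)
  open import Data.Sum using (_⊎_; inj₁; inj₂)
  open import Data.Empty using (⊥; ⊥-elim)
  open import Relation.Binary.PropositionalEquality hiding ([_])

  bool-ext : ∀ {b c : Bool} → (b ≡ true → c ≡ true) → (c ≡ true → b ≡ true) → b ≡ c
  bool-ext {true} {true} f g = refl
  bool-ext {true} {false} f g = sym (f refl)
  bool-ext {false} {true} f g = g refl
  bool-ext {false} {false} f g = refl

  true≢false : true ≡ false → ⊥
  true≢false ()

  not-true : ∀ {b} → (b ≡ true → ⊥) → b ≡ false
  not-true {true} h = ⊥-elim (h refl)
  not-true {false} h = refl

  ∧-true₁ : ∀ {a b} → (a ∧ b) ≡ true → a ≡ true
  ∧-true₁ {true} e = refl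

  ∧-true₂ : ∀ {a b} → (a ∧ b) ≡ true → b ≡ true
  ∧-true₂ {true} e = e

  ∨-true : ∀ {a b} → (a ∨ b) ≡ true → (a ≡ true) ⊎ (b ≡ true)
  ∨-true {true} e = inj₁ refl
  ∨-true {false} e = inj₂ e

  ∨-swap : ∀ a b c → (a ∨ (b ∨ c)) ≡ (b ∨ (a ∨ c))
  ∨-swap true true c = refl
  ∨-swap true false c = refl
  ∨-swap false b c = refl

  ≡ᵇ-refl : ∀ x → (x ≡ᵇ x) ≡ true
  ≡ᵇ-refl zero = refl
  ≡ᵇ-refl (suc x) = ≡ᵇ-refl x

  ≡ᵇ-true : ∀ m n → (m ≡ᵇ n) ≡ true → m ≡ n
  ≡ᵇ-true m n e = ℕP.≡ᵇ⇒≡ m n (subst T (sym e) _)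

  ≡ᵇ-false : ∀ {m n} → m ≢ n → (m ≡ᵇ n) ≡ false
  ≡ᵇ-false {m} {n} ne = not-true (λ e → ne (≡ᵇ-true m n e))

  <ᵇ-true : ∀ m n → m < n → (m <ᵇ n) ≡ true
  <ᵇ-true zero (suc n) lt = refl
  <ᵇ-true (suc m) (suc n) (s≤s lt) = <ᵇ-true m n lt

  <ᵇ-false : ∀ m n → n ≤ m → (m <ᵇ n) ≡ false
  <ᵇ-false m zero le = refl
  <ᵇ-false (suc m) (suc n) (s≤s le) = <ᵇ-false m n le

  <ᵇ-sound : ∀ m n → (m <ᵇ n) ≡ true → m < n
  <ᵇ-sound m n e = ℕP.<ᵇ⇒< m n (subst T (sym e) _)

  ≤ᵇ-true : ∀ {a b} → a ≤ b → (a ≤ᵇ b) ≡ true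
  ≤ᵇ-true {a} {b} le with a ≤ᵇ b in e
  ... | true = refl
  ... | false = ⊥-elim (subst T e (ℕP.≤⇒≤ᵇ le))

  ≤ᵇ-false : ∀ {a b} → a < b → (b ≤ᵇ a) ≡ false
  ≤ᵇ-false {a} {suc b} (s≤s le) = <ᵇ-false b a le

  trichotomy : ∀ z p → (z < p) ⊎ ((z ≡ p) ⊎ Σ ℕ (λ k → z ≡ suc (p + k)))
  trichotomy zero zero = inj₂ (inj₁ refl)
  trichotomy zero (suc p) = inj₁ (s≤s z≤n)
  trichotomy (suc z) zero = inj₂ (inj₂ (z , refl))
  trichotomy (suc z) (suc p) with trichotomy z p
  ... | inj₁ lt = inj₁ (s≤s lt)
  ... | inj₂ (inj₁ e) = inj₂ (inj₁ (cong suc e))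
  ... | inj₂ (inj₂ (k , e)) = inj₂ (inj₂ (k , cong suc e))

  dichotomy : ∀ z p → (z ≤ p) ⊎ Σ ℕ (λ k → z ≡ suc (p + k))
  dichotomy zero p = inj₁ z≤n
  dichotomy (suc z) zero = inj₂ (z , refl)
  dichotomy (suc z) (suc p) with dichotomy z p
  ... | inj₁ le = inj₁ (s≤s le)
  ... | inj₂ (k , e) = inj₂ (k , cong suc e)

  ∈-cons-true : ∀ z y L → z ∈ᵇ (y ∷ L) ≡ true → (z ≡ y) ⊎ (z ∈ᵇ L ≡ true)
  ∈-cons-true z y L e with ∨-true {z ≡ᵇ y} e
  ... | inj₁ q = inj₁ (≡ᵇ-true z y q)
  ... | inj₂ q = inj₂ q

  ∈-here : ∀ z A B → z ∈ᵇ (A ++ z ∷ B) ≡ true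
  ∈-here z [] B rewrite ≡ᵇ-refl z = refl
  ∈-here z (x ∷ A) B rewrite ∈-here z A B = ∨-zeroʳ (z ≡ᵇ x)

  ∈-there : ∀ z y L → z ∈ᵇ L ≡ true → z ∈ᵇ (y ∷ L) ≡ true
  ∈-there z y L e rewrite e = ∨-zeroʳ (z ≡ᵇ y)

  ∈ᵇ-++ : ∀ z A B → z ∈ᵇ (A ++ B) ≡ ((z ∈ᵇ A) ∨ (z ∈ᵇ B))
  ∈ᵇ-++ z [] B = refl
  ∈ᵇ-++ z (x ∷ A) B rewrite ∈ᵇ-++ z A B with z ≡ᵇ x
  ... | true = refl
  ... | false = refl

  ∉-All< : ∀ a w → All (_< a) w → a ∈ᵇ w ≡ false
  ∉-All< a [] [] = refl
  ∉-All< a (y ∷ w) (lt ∷ h) rewrite ≡ᵇ-false {a} {y} (λ e → ℕP.<-irrefl (sym e) lt) = ∉-All< a w h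

  ∈-filter : ∀ (q : ℕ → Bool) L z → z ∈ᵇ filterᵇ q L ≡ (q z ∧ (z ∈ᵇ L))
  ∈-filter q [] z = sym (∧-zeroʳ (q z))
  ∈-filter q (y ∷ L) z with q y in qy
  ... | true = trans (cong ((z ≡ᵇ y) ∨_) (∈-filter q L z)) (kept (z ≡ᵇ y) refl)
    where
    kept : ∀ b → (z ≡ᵇ y) ≡ b → (b ∨ (q z ∧ (z ∈ᵇ L))) ≡ (q z ∧ (b ∨ (z ∈ᵇ L)))
    kept true e rewrite ≡ᵇ-true z y e | qy = refl
    kept false e with q z
    ... | true = refl
    ... | false = refl
  ... | false = trans (∈-filter q L z) (dropped (z ≡ᵇ y) refl)
    where
    dropped : ∀ b → (z ≡ᵇ y) ≡ b → (q z ∧ (z ∈ᵇ L)) ≡ (q z ∧ (b ∨ (z ∈ᵇ L)))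
    dropped true e rewrite ≡ᵇ-true z y e | qy = refl
    dropped false e = refl

  ∈-map-pred : ∀ L z → z ∈ᵇ map pred L ≡ ((suc z ∈ᵇ L) ∨ ((z ≡ᵇ 0) ∧ (0 ∈ᵇ L)))
  ∈-map-pred [] z = sym (∧-zeroʳ (z ≡ᵇ 0))
  ∈-map-pred (zero ∷ L) z rewrite ∈-map-pred L z with z ≡ᵇ 0 | suc z ∈ᵇ L | 0 ∈ᵇ L
  ... | true | true | _ = refl
  ... | true | false | _ = refl
  ... | false | _ | _ = refl
  ∈-map-pred (suc y ∷ L) z rewrite ∈-map-pred L z with z ≡ᵇ y
  ... | true = refl
  ... | false = refl

  allᵇ-elim : ∀ (q : ℕ → Bool) L → all q L ≡ true → ∀ z → z ∈ᵇ L ≡ true → q z ≡ true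
  allᵇ-elim q (y ∷ L) e z m with ∈-cons-true z y L m
  ... | inj₁ refl = ∧-true₁ e
  ... | inj₂ m' = allᵇ-elim q L (∧-true₂ {q y} e) z m'

  allᵇ-intro : ∀ (q : ℕ → Bool) L → (∀ z → z ∈ᵇ L ≡ true → q z ≡ true) → all q L ≡ true
  allᵇ-intro q [] h = refl
  allᵇ-intro q (y ∷ L) h rewrite h y (∈-here y [] L) = allᵇ-intro q L (λ z m → h z (∈-there z y L m))

  sameSet-sound : ∀ A B → sameSet A B ≡ true → ∀ z → z ∈ᵇ A ≡ z ∈ᵇ B
  sameSet-sound A B e z = bool-ext (allᵇ-elim (λ a → a ∈ᵇ B) A (∧-true₁ e) z)
                                   (allᵇ-elim (λ b → b ∈ᵇ A) B (∧-true₂ {all (λ a → a ∈ᵇ B) A} e) z)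

  sameSet-complete : ∀ A B → (∀ z → z ∈ᵇ A ≡ z ∈ᵇ B) → sameSet A B ≡ true
  sameSet-complete A B h rewrite allᵇ-intro (λ a → a ∈ᵇ B) A (λ z m → trans (sym (h z)) m) =
    allᵇ-intro (λ b → b ∈ᵇ A) B (λ z m → trans (h z) m)

  sameSet-false : ∀ A B z → z ∈ᵇ A ≡ true → z ∈ᵇ B ≡ false → sameSet A B ≡ false
  sameSet-false A B z a b = not-true (λ e → true≢false (trans (sym a) (trans (sameSet-sound A B e z) b)))

  sameSet-false' : ∀ A B z → z ∈ᵇ A ≡ false → z ∈ᵇ B ≡ true → sameSet A B ≡ false
  sameSet-false' A B z a b = not-true (λ e → true≢false (trans (sym b) (trans (sym (sameSet-sound A B e z)) a)))

  sameSet-resp : ∀ A A' B B' → (∀ z → z ∈ᵇ A ≡ z ∈ᵇ A') → (∀ z → z ∈ᵇ B ≡ z ∈ᵇ B') → sameSet A B ≡ sameSet A' B'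
  sameSet-resp A A' B B' hA hB = bool-ext
    (λ e → sameSet-complete A' B' (λ z → trans (sym (hA z)) (trans (sameSet-sound A B e z) (hB z))))
    (λ e → sameSet-complete A B (λ z → trans (hA z) (trans (sameSet-sound A' B' e z) (sym (hB z)))))

  ∈-snoc-other : ∀ z K a → z ≢ a → z ∈ᵇ (K ++ [ a ]) ≡ z ∈ᵇ K
  ∈-snoc-other z K a z≢a rewrite ∈ᵇ-++ z K [ a ] | ≡ᵇ-false z≢a = ∨-identityʳ (z ∈ᵇ K)

  ∈-snoc-self : ∀ K a → a ∈ᵇ (K ++ [ a ]) ≡ true
  ∈-snoc-self K a = ∈-here a K []

  ∧-not-absorbs : ∀ c y w → (not c ∧ (y ∨ (c ∧ w))) ≡ (not c ∧ y)
  ∧-not-absorbs true y w = refl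
  ∧-not-absorbs false true w = refl
  ∧-not-absorbs false false w = refl

  mx-ub : ∀ L z → z ∈ᵇ L ≡ true → z ≤ mx L
  mx-ub (y ∷ L) z z∈ with ∈-cons-true z y L z∈
  ... | inj₁ refl = ℕP.m≤m⊔n z (mx L)
  ... | inj₂ z∈L = ℕP.≤-trans (mx-ub L z z∈L) (ℕP.m≤n⊔m y (mx L))

  mx-lub : ∀ L B → (∀ z → z ∈ᵇ L ≡ true → z ≤ B) → mx L ≤ B
  mx-lub [] B ub = z≤n
  mx-lub (y ∷ L) B ub = ℕP.⊔-lub (ub y (∈-here y [] L)) (mx-lub L B (λ z z∈L → ub z (∈-there z y L z∈L)))

  mx-∈ : ∀ y L → mx (y ∷ L) ∈ᵇ (y ∷ L) ≡ true
  mx-∈ y [] rewrite ℕP.⊔-identityʳ y = ∈-here y [] []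
  mx-∈ y (w ∷ L) with ℕP.⊔-sel y (mx (w ∷ L))
  ... | inj₁ e rewrite e = ∈-here y [] (w ∷ L)
  ... | inj₂ e rewrite e = ∈-there (mx (w ∷ L)) y (w ∷ L) (mx-∈ w L)

  All-intro : ∀ {P : ℕ → Set} L → (∀ z → z ∈ᵇ L ≡ true → P z) → All P L
  All-intro [] h = []
  All-intro (y ∷ L) h = h y (∈-here y [] L) ∷ All-intro L (λ z z∈L → h z (∈-there z y L z∈L))

  All-elim : ∀ {P : ℕ → Set} L → All P L → ∀ z → z ∈ᵇ L ≡ true → P z
  All-elim (y ∷ L) (py ∷ ps) z z∈ with ∈-cons-true z y L z∈
  ... | inj₁ refl = py
  ... | inj₂ z∈L = All-elim L ps z z∈L

  0∉⇒positive : ∀ L → 0 ∈ᵇ L ≡ false → All (λ j → 0 < j) L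
  0∉⇒positive L 0∉L = All-intro L (λ { zero z∈ → ⊥-elim (true≢false (trans (sym z∈) 0∉L)) ; (suc z) _ → s≤s z≤n })

  positive⇒0∉ : ∀ L → All (λ j → 0 < j) L → 0 ∈ᵇ L ≡ false
  positive⇒0∉ L pos = not-true (λ 0∈L → ℕP.<-irrefl refl (All-elim L pos 0 0∈L))

  bound-tighten : ∀ K a → (∀ z → z ∈ᵇ K ≡ true → z < suc a) → a ∈ᵇ K ≡ false → ∀ z → z ∈ᵇ K ≡ true → z < a
  bound-tighten K a K<a+1 a∉K z z∈K with ℕP.m≤n⇒m<n∨m≡n (ℕP.≤-pred (K<a+1 z z∈K))
  ... | inj₁ z<a = z<a
  ... | inj₂ refl = ⊥-elim (true≢false (trans (sym z∈K) a∉K))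

module FiniteSums where
  open import Defs
  open NatCast
  open BoolSets
  open import Data.Nat using (ℕ; zero; suc; _+_; _*_; _<_; _≤_; z≤n; s≤s; _≡ᵇ_)
  import Data.Nat.Properties as ℕP
  open import Data.Bool using (Bool; true; false; _∧_; if_then_else_)
  open import Data.List using (List; []; _∷_; [_]; _++_; map; concatMap; upTo; applyUpTo)
  import Data.List.Properties as LP
  open import Data.List.Relation.Unary.All using (All; []; _∷_)
  open import Data.Sum using (inj₁; inj₂)
  import Data.Rational as ℚ
  import Data.Rational.Properties as ℚP
  open import Relation.Binary.PropositionalEquality hiding ([_])
  open ≡-Reasoning

  ∑ : {A : Set} → List A → (A → ℕ) → ℕ
  ∑ [] f = 0
  ∑ (x ∷ xs) f = f x + ∑ xs f

  𝟙 : Bool → ℕ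
  𝟙 true = 1
  𝟙 false = 0

  𝟙-∧ : ∀ a b → 𝟙 (a ∧ b) ≡ 𝟙 a * 𝟙 b
  𝟙-∧ true b = sym (ℕP.+-identityʳ (𝟙 b))
  𝟙-∧ false b = refl

  ∑-cong : {A : Set} (L : List A) {f g : A → ℕ} → (∀ x → f x ≡ g x) → ∑ L f ≡ ∑ L g
  ∑-cong [] e = refl
  ∑-cong (x ∷ L) e = cong₂ _+_ (e x) (∑-cong L e)

  ∑-zero : {A : Set} (L : List A) {f : A → ℕ} → (∀ x → f x ≡ 0) → ∑ L f ≡ 0
  ∑-zero [] e = refl
  ∑-zero (x ∷ L) e = cong₂ _+_ (e x) (∑-zero L e)

  ∑-++ : {A : Set} (L M : List A) (f : A → ℕ) → ∑ (L ++ M) f ≡ ∑ L f + ∑ M f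
  ∑-++ [] M f = refl
  ∑-++ (x ∷ L) M f = trans (cong (f x +_) (∑-++ L M f)) (sym (ℕP.+-assoc (f x) _ _))

  ∑-map : {A B : Set} (g : A → B) (L : List A) (f : B → ℕ) → ∑ (map g L) f ≡ ∑ L (λ x → f (g x))
  ∑-map g [] f = refl
  ∑-map g (x ∷ L) f = cong (f (g x) +_) (∑-map g L f)

  ∑-concatMap : {A B : Set} (g : A → List B) (L : List A) (f : B → ℕ) → ∑ (concatMap g L) f ≡ ∑ L (λ x → ∑ (g x) f)
  ∑-concatMap g [] f = refl
  ∑-concatMap g (x ∷ L) f = trans (∑-++ (g x) (concatMap g L) f) (cong (∑ (g x) f +_) (∑-concatMap g L f))

  ∑-+ : {A : Set} (L : List A) (f g : A → ℕ) → ∑ L (λ x → f x + g x) ≡ ∑ L f + ∑ L g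
  ∑-+ [] f g = refl
  ∑-+ (x ∷ L) f g = begin
    f x + g x + ∑ L (λ x → f x + g x) ≡⟨ cong (f x + g x +_) (∑-+ L f g) ⟩
    f x + g x + (∑ L f + ∑ L g) ≡⟨ ℕP.+-assoc (f x) (g x) _ ⟩
    f x + (g x + (∑ L f + ∑ L g)) ≡⟨ cong (f x +_) (sym (ℕP.+-assoc (g x) _ _)) ⟩
    f x + (g x + ∑ L f + ∑ L g) ≡⟨ cong (λ t → f x + (t + ∑ L g)) (ℕP.+-comm (g x) _) ⟩
    f x + (∑ L f + g x + ∑ L g) ≡⟨ cong (f x +_) (ℕP.+-assoc (∑ L f) _ _) ⟩
    f x + (∑ L f + (g x + ∑ L g)) ≡⟨ sym (ℕP.+-assoc (f x) _ _) ⟩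
    f x + ∑ L f + (g x + ∑ L g) ∎

  ∑-scalar : {A : Set} (L : List A) (c : ℕ) (f : A → ℕ) → ∑ L (λ x → c * f x) ≡ c * ∑ L f
  ∑-scalar [] c f = sym (ℕP.*-zeroʳ c)
  ∑-scalar (x ∷ L) c f = trans (cong (c * f x +_) (∑-scalar L c f)) (sym (ℕP.*-distribˡ-+ c (f x) _))

  ∑-swap : {A B : Set} (L : List A) (M : List B) (f : A → B → ℕ) → ∑ L (λ x → ∑ M (f x)) ≡ ∑ M (λ y → ∑ L (λ x → f x y))
  ∑-swap [] M f = sym (∑-zero M (λ _ → refl))
  ∑-swap (x ∷ L) M f = begin
    ∑ M (f x) + ∑ L (λ x → ∑ M (f x)) ≡⟨ cong (∑ M (f x) +_) (∑-swap L M f) ⟩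
    ∑ M (f x) + ∑ M (λ y → ∑ L (λ x → f x y)) ≡⟨ sym (∑-+ M (f x) _) ⟩
    ∑ M (λ y → f x y + ∑ L (λ x → f x y)) ∎

  ∑-applyUpTo-cong : ∀ (h : ℕ → ℕ) n {f g : ℕ → ℕ} → (∀ x → x < n → f (h x) ≡ g (h x)) → ∑ (applyUpTo h n) f ≡ ∑ (applyUpTo h n) g
  ∑-applyUpTo-cong h zero e = refl
  ∑-applyUpTo-cong h (suc n) e = cong₂ _+_ (e 0 (s≤s z≤n)) (∑-applyUpTo-cong (λ x → h (suc x)) n (λ x lt → e (suc x) (s≤s lt)))

  ∑-upTo-cong : ∀ n {f g : ℕ → ℕ} → (∀ x → x < n → f x ≡ g x) → ∑ (upTo n) f ≡ ∑ (upTo n) g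
  ∑-upTo-cong n = ∑-applyUpTo-cong (λ x → x) n

  ∑-upTo-suc : ∀ n (f : ℕ → ℕ) → ∑ (upTo (suc n)) f ≡ ∑ (upTo n) f + f n
  ∑-upTo-suc n f = begin
    ∑ (upTo (suc n)) f ≡⟨ cong (λ L → ∑ L f) (sym (LP.upTo-∷ʳ n)) ⟩
    ∑ (upTo n ++ [ n ]) f ≡⟨ ∑-++ (upTo n) [ n ] f ⟩
    ∑ (upTo n) f + (f n + 0) ≡⟨ cong (∑ (upTo n) f +_) (ℕP.+-identityʳ (f n)) ⟩
    ∑ (upTo n) f + f n ∎

  ∑-upTo-suc' : ∀ n (f : ℕ → ℕ) → ∑ (upTo (suc n)) f ≡ f 0 + ∑ (upTo n) (λ p → f (suc p))
  ∑-upTo-suc' n f = cong (f 0 +_) (trans (cong (λ L → ∑ L f) (sym (LP.map-upTo suc n))) (∑-map suc (upTo n) f))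

  ∑-upTo-trunc : ∀ m j (f : ℕ → ℕ) → (∀ p → m ≤ p → f p ≡ 0) → ∑ (upTo (m + j)) f ≡ ∑ (upTo m) f
  ∑-upTo-trunc m zero f h = cong (λ t → ∑ (upTo t) f) (ℕP.+-identityʳ m)
  ∑-upTo-trunc m (suc j) f h = begin
    ∑ (upTo (m + suc j)) f ≡⟨ cong (λ t → ∑ (upTo t) f) (ℕP.+-suc m j) ⟩
    ∑ (upTo (suc (m + j))) f ≡⟨ ∑-upTo-suc (m + j) f ⟩
    ∑ (upTo (m + j)) f + f (m + j) ≡⟨ cong₂ _+_ (∑-upTo-trunc m j f h) (h (m + j) (ℕP.m≤m+n m j)) ⟩
    ∑ (upTo m) f + 0 ≡⟨ ℕP.+-identityʳ _ ⟩
    ∑ (upTo m) f ∎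

  𝟙-≡ᵇ-false : ∀ p q → p ≢ q → 𝟙 (p ≡ᵇ q) ≡ 0
  𝟙-≡ᵇ-false p q ne rewrite ≡ᵇ-false ne = refl

  ∑-delta-absent : ∀ n q (G : ℕ → ℕ) → n ≤ q → ∑ (upTo n) (λ p → 𝟙 (p ≡ᵇ q) * G p) ≡ 0
  ∑-delta-absent n q G le =
    trans (∑-upTo-cong n (λ p lt → cong (_* G p) (𝟙-≡ᵇ-false p q (λ e → ℕP.<-irrefl e (ℕP.<-≤-trans lt le)))))
          (∑-zero (upTo n) (λ _ → refl))

  ∑-delta : ∀ n q (G : ℕ → ℕ) → q < n → ∑ (upTo n) (λ p → 𝟙 (p ≡ᵇ q) * G p) ≡ G q
  ∑-delta (suc n) q G (s≤s le) with ℕP.m≤n⇒m<n∨m≡n le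
  ... | inj₁ lt = begin
    ∑ (upTo (suc n)) (λ p → 𝟙 (p ≡ᵇ q) * G p) ≡⟨ ∑-upTo-suc n _ ⟩
    ∑ (upTo n) (λ p → 𝟙 (p ≡ᵇ q) * G p) + 𝟙 (n ≡ᵇ q) * G n ≡⟨ cong₂ _+_ (∑-delta n q G lt) (cong (_* G n) (𝟙-≡ᵇ-false n q (λ e → ℕP.<-irrefl (sym e) lt))) ⟩
    G q + 0 ≡⟨ ℕP.+-identityʳ _ ⟩
    G q ∎
  ... | inj₂ refl = begin
    ∑ (upTo (suc q)) (λ p → 𝟙 (p ≡ᵇ q) * G p) ≡⟨ ∑-upTo-suc q _ ⟩
    ∑ (upTo q) (λ p → 𝟙 (p ≡ᵇ q) * G p) + 𝟙 (q ≡ᵇ q) * G q ≡⟨ cong₂ _+_ (∑-delta-absent q q G ℕP.≤-refl) (cong (λ b → 𝟙 b * G q) (≡ᵇ-refl q)) ⟩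
    0 + (G q + 0) ≡⟨ ℕP.+-identityʳ _ ⟩
    G q ∎


  ℕtoℚ-∑ : {A : Set} (L : List A) (f : A → ℕ) → ℕtoℚ (∑ L f) ≡ sumℚ (map (λ x → ℕtoℚ (f x)) L)
  ℕtoℚ-∑ [] f = refl
  ℕtoℚ-∑ (x ∷ L) f = trans (ℕtoℚ-+ (f x) (∑ L f)) (cong (λ t → ℕtoℚ (f x) ℚ.+ t) (ℕtoℚ-∑ L f))

  ℕtoℚ-𝟙 : ∀ b k → ℕtoℚ (𝟙 b * k) ≡ (if b then ℕtoℚ k else ℚ.0ℚ)
  ℕtoℚ-𝟙 true k = cong ℕtoℚ (ℕP.*-identityˡ k)
  ℕtoℚ-𝟙 false k = refl

  sumℚ-cong : {A : Set} (L : List A) {f g : A → ℚ.ℚ} → All (λ e → f e ≡ g e) L → sumℚ (map f L) ≡ sumℚ (map g L)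
  sumℚ-cong [] [] = refl
  sumℚ-cong (x ∷ L) (e ∷ es) = cong₂ ℚ._+_ e (sumℚ-cong L es)

  ℕtoℚ-guarded : ∀ b k (q : ℚ.ℚ) → (b ≡ true → ℕtoℚ k ≡ q) → ℕtoℚ (𝟙 b * k) ≡ ℕtoℚ (𝟙 b) ℚ.* q
  ℕtoℚ-guarded true k q h = trans (cong ℕtoℚ (ℕP.*-identityˡ k)) (trans (h refl) (sym (ℚP.*-identityˡ q)))
  ℕtoℚ-guarded false k q h = sym (ℚP.*-zeroˡ q)

-- Sums over arrangements (words without repeated letters) and the
-- insertion decomposition of permutations: a permutation of {0,…,n} is a
-- permutation of {0,…,n-1} with the letter n inserted somewhere.
module Arrangements where
  open import Defs
  open BoolSets
  open FiniteSums
  open import Data.Nat using (ℕ; zero; suc; _+_; _*_; _<_; _≤_; s≤s; _≡ᵇ_)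
  import Data.Nat.Properties as ℕP
  open import Data.Bool using (Bool; true; false; not; _∧_; _∨_)
  open import Data.List using (List; []; _∷_; map; upTo; filterᵇ; length)
  open import Data.List.Relation.Unary.All using (All; []; _∷_)
  open import Relation.Binary.PropositionalEquality
  open ≡-Reasoning

  -- ins p a σ inserts the letter a at (0-based) position p of σ.
  ins : ℕ → ℕ → List ℕ → List ℕ
  ins zero a σ = a ∷ σ
  ins (suc p) a [] = a ∷ []
  ins (suc p) a (x ∷ σ) = x ∷ ins p a σ

  ∈-ins : ∀ x p a σ → x ∈ᵇ ins p a σ ≡ ((x ≡ᵇ a) ∨ (x ∈ᵇ σ))
  ∈-ins x zero a σ = refl
  ∈-ins x (suc p) a [] = refl
  ∈-ins x (suc p) a (y ∷ σ) = trans (cong ((x ≡ᵇ y) ∨_) (∈-ins x p a σ)) (∨-swap (x ≡ᵇ y) (x ≡ᵇ a) _)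

  ∈-ins-self : ∀ p a σ → a ∈ᵇ ins p a σ ≡ true
  ∈-ins-self p a σ = trans (∈-ins a p a σ) (cong (_∨ (a ∈ᵇ σ)) (≡ᵇ-refl a))

  ∑arr : ℕ → ℕ → (List ℕ → ℕ) → ℕ
  ∑arr a k f = ∑ (words a k) (λ w → 𝟙 (distinct w) * f w)

  words-cong : ∀ a k {f g : List ℕ → ℕ} → (∀ w → All (_< a) w → length w ≡ k → f w ≡ g w) → ∑ (words a k) f ≡ ∑ (words a k) g
  words-cong a zero e = cong (_+ 0) (e [] [] refl)
  words-cong a (suc k) {f} {g} e = begin
    ∑ (words a (suc k)) f ≡⟨ ∑-concatMap (λ x → map (x ∷_) (words a k)) (upTo a) f ⟩
    ∑ (upTo a) (λ x → ∑ (map (x ∷_) (words a k)) f) ≡⟨ ∑-upTo-cong a (λ x lt → trans (∑-map (x ∷_) (words a k) f) (trans (words-cong a k (λ w al le → e (x ∷ w) (lt ∷ al) (cong suc le))) (sym (∑-map (x ∷_) (words a k) g)))) ⟩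
    ∑ (upTo a) (λ x → ∑ (map (x ∷_) (words a k)) g) ≡⟨ sym (∑-concatMap (λ x → map (x ∷_) (words a k)) (upTo a) g) ⟩
    ∑ (words a (suc k)) g ∎

  ∑arr-cong : ∀ a k {F G : List ℕ → ℕ} → (∀ w → All (_< a) w → length w ≡ k → F w ≡ G w) → ∑arr a k F ≡ ∑arr a k G
  ∑arr-cong a k e = words-cong a k (λ w al le → cong (𝟙 (distinct w) *_) (e w al le))

  ∑arr-congf : ∀ a k {F G : List ℕ → ℕ} → (∀ w → F w ≡ G w) → ∑arr a k F ≡ ∑arr a k G
  ∑arr-congf a k e = ∑arr-cong a k (λ w _ _ → e w)

  ∑arr-+ : ∀ a k F G → ∑arr a k (λ w → F w + G w) ≡ ∑arr a k F + ∑arr a k G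
  ∑arr-+ a k F G = trans (∑-cong (words a k) (λ w → ℕP.*-distribˡ-+ (𝟙 (distinct w)) (F w) (G w))) (∑-+ (words a k) _ _)

  ∑arr-zero : ∀ a k F → (∀ w → All (_< a) w → length w ≡ k → F w ≡ 0) → ∑arr a k F ≡ 0
  ∑arr-zero a k F e = trans (∑arr-cong a k {G = λ _ → 0} e) (∑-zero (words a k) (λ w → ℕP.*-zeroʳ (𝟙 (distinct w))))

  ∑arr-scalar : ∀ a k c F → ∑arr a k (λ w → c * F w) ≡ c * ∑arr a k F
  ∑arr-scalar a k c F = trans (∑-cong (words a k) (λ w → trans (sym (ℕP.*-assoc (𝟙 (distinct w)) c (F w))) (trans (cong (_* F w) (ℕP.*-comm (𝟙 (distinct w)) c)) (ℕP.*-assoc c _ (F w))))) (∑-scalar (words a k) c _)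

  ∑arr-swap : ∀ {B : Set} a k (M : List B) (F : B → List ℕ → ℕ) → ∑arr a k (λ w → ∑ M (λ y → F y w)) ≡ ∑ M (λ y → ∑arr a k (F y))
  ∑arr-swap a k M F = trans (∑-cong (words a k) (λ w → sym (∑-scalar M (𝟙 (distinct w)) (λ y → F y w)))) (∑-swap (words a k) M (λ w y → 𝟙 (distinct w) * F y w))

  ∑arr-suc : ∀ a k f → ∑arr a (suc k) f ≡ ∑ (upTo a) (λ x → ∑arr a k (λ w → 𝟙 (not (x ∈ᵇ w)) * f (x ∷ w)))
  ∑arr-suc a k f = begin
    ∑arr a (suc k) f ≡⟨ ∑-concatMap (λ x → map (x ∷_) (words a k)) (upTo a) _ ⟩
    ∑ (upTo a) (λ x → ∑ (map (x ∷_) (words a k)) (λ w → 𝟙 (distinct w) * f w)) ≡⟨ ∑-cong (upTo a) (λ x → trans (∑-map (x ∷_) (words a k) _) (∑-cong (words a k) (λ w → fresh-head x w))) ⟩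
    ∑ (upTo a) (λ x → ∑arr a k (λ w → 𝟙 (not (x ∈ᵇ w)) * f (x ∷ w))) ∎
    where
    fresh-head : ∀ x w → 𝟙 (not (x ∈ᵇ w) ∧ distinct w) * f (x ∷ w) ≡ 𝟙 (distinct w) * (𝟙 (not (x ∈ᵇ w)) * f (x ∷ w))
    fresh-head x w = begin
      𝟙 (not (x ∈ᵇ w) ∧ distinct w) * f (x ∷ w) ≡⟨ cong (_* f (x ∷ w)) (𝟙-∧ (not (x ∈ᵇ w)) (distinct w)) ⟩
      𝟙 (not (x ∈ᵇ w)) * 𝟙 (distinct w) * f (x ∷ w) ≡⟨ cong (_* f (x ∷ w)) (ℕP.*-comm (𝟙 (not (x ∈ᵇ w))) _) ⟩
      𝟙 (distinct w) * 𝟙 (not (x ∈ᵇ w)) * f (x ∷ w) ≡⟨ ℕP.*-assoc (𝟙 (distinct w)) _ _ ⟩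
      𝟙 (distinct w) * (𝟙 (not (x ∈ᵇ w)) * f (x ∷ w)) ∎

  -- ∑arrWith a k f sums f over the arrangements of length k over {0,…,a}
  -- that use the letter a, written as an arrangement σ over {0,…,a-1} with a
  -- inserted at one of the k positions.
  ∑arrWith : ℕ → ℕ → (List ℕ → ℕ) → ℕ
  ∑arrWith a zero f = 0
  ∑arrWith a (suc k) f = ∑arr a k (λ σ → ∑ (upTo (suc k)) (λ p → f (ins p a σ)))

  -- An arrangement containing a cannot be extended by a at the front.
  ∑arrWith-repeat : ∀ a k (f : List ℕ → ℕ) → ∑arrWith a k (λ w → 𝟙 (not (a ∈ᵇ w)) * f (a ∷ w)) ≡ 0
  ∑arrWith-repeat a zero f = refl
  ∑arrWith-repeat a (suc k) f = ∑arr-zero a k _ (λ σ _ _ → ∑-zero (upTo (suc k)) (λ p → cong (λ b → 𝟙 (not b) * f (a ∷ ins p a σ)) (∈-ins-self p a σ)))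

  ∑arrWith-shift : ∀ a k (f : List ℕ → ℕ) → ∑ (upTo a) (λ x → ∑arrWith a k (λ w → 𝟙 (not (x ∈ᵇ w)) * f (x ∷ w)))
                   ≡ ∑arr a k (λ σ → ∑ (upTo k) (λ p → f (ins (suc p) a σ)))
  ∑arrWith-shift a zero f = ∑-zero (upTo a) (λ _ → refl)
  ∑arrWith-shift a (suc k) f = begin
    ∑ (upTo a) (λ x → ∑arr a k (λ σ → ∑ (upTo (suc k)) (λ p → 𝟙 (not (x ∈ᵇ ins p a σ)) * f (x ∷ ins p a σ))))
      ≡⟨ ∑-upTo-cong a (λ x lt → ∑arr-congf a k (λ σ → insert-behind x lt σ)) ⟩
    ∑ (upTo a) (λ x → ∑arr a k (λ w → 𝟙 (not (x ∈ᵇ w)) * ∑ (upTo (suc k)) (λ p → f (ins (suc p) a (x ∷ w)))))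
      ≡⟨ sym (∑arr-suc a k _) ⟩
    ∑arr a (suc k) (λ σ → ∑ (upTo (suc k)) (λ p → f (ins (suc p) a σ))) ∎
    where
    insert-behind : ∀ x → x < a → ∀ σ → ∑ (upTo (suc k)) (λ p → 𝟙 (not (x ∈ᵇ ins p a σ)) * f (x ∷ ins p a σ))
                            ≡ 𝟙 (not (x ∈ᵇ σ)) * ∑ (upTo (suc k)) (λ p → f (ins (suc p) a (x ∷ σ)))
    insert-behind x lt σ = trans (∑-cong (upTo (suc k)) (λ p → cong (λ b → 𝟙 (not b) * f (x ∷ ins p a σ)) (trans (∈-ins x p a σ) (cong (_∨ (x ∈ᵇ σ)) (≡ᵇ-false (ℕP.<⇒≢ lt))))))
                      (∑-scalar (upTo (suc k)) (𝟙 (not (x ∈ᵇ σ))) (λ p → f (ins (suc p) a (x ∷ σ))))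

  -- Arrangements over {0,…,a} either avoid a or contain it exactly once.
  ∑arr-split : ∀ k a (f : List ℕ → ℕ) → ∑arr (suc a) k f ≡ ∑arr a k f + ∑arrWith a k f
  ∑arr-split zero a f = sym (ℕP.+-identityʳ _)
  ∑arr-split (suc k) a f = begin
    ∑arr (suc a) (suc k) f ≡⟨ ∑arr-suc (suc a) k f ⟩
    ∑ (upTo (suc a)) (λ x → ∑arr (suc a) k (h x)) ≡⟨ ∑-upTo-suc a _ ⟩
    ∑ (upTo a) (λ x → ∑arr (suc a) k (h x)) + ∑arr (suc a) k (h a) ≡⟨ cong₂ _+_ (∑-cong (upTo a) (λ x → ∑arr-split k a (h x))) (∑arr-split k a (h a)) ⟩
    ∑ (upTo a) (λ x → ∑arr a k (h x) + ∑arrWith a k (h x)) + (∑arr a k (h a) + ∑arrWith a k (h a)) ≡⟨ cong₂ _+_ (∑-+ (upTo a) _ _) (cong₂ _+_ head-a (∑arrWith-repeat a k f)) ⟩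
    (∑ (upTo a) (λ x → ∑arr a k (h x)) + ∑ (upTo a) (λ x → ∑arrWith a k (h x))) + (∑arr a k (λ w → f (a ∷ w)) + 0) ≡⟨ cong₂ (λ s t → (s + t) + (∑arr a k (λ w → f (a ∷ w)) + 0)) (sym (∑arr-suc a k f)) (∑arrWith-shift a k f) ⟩
    (∑arr a (suc k) f + Y) + (Z + 0) ≡⟨ arith (∑arr a (suc k) f) Y Z ⟩
    ∑arr a (suc k) f + (Z + Y) ≡⟨ cong (∑arr a (suc k) f +_) (sym (∑arr-+ a k _ _)) ⟩
    ∑arr a (suc k) f + ∑arr a k (λ σ → f (a ∷ σ) + ∑ (upTo k) (λ p → f (ins (suc p) a σ))) ≡⟨ cong (∑arr a (suc k) f +_) (∑arr-congf a k (λ σ → sym (∑-upTo-suc' k (λ p → f (ins p a σ))))) ⟩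
    ∑arr a (suc k) f + ∑arrWith a (suc k) f ∎
    where
    h : ℕ → List ℕ → ℕ
    h x w = 𝟙 (not (x ∈ᵇ w)) * f (x ∷ w)
    Y Z : ℕ
    Y = ∑arr a k (λ σ → ∑ (upTo k) (λ p → f (ins (suc p) a σ)))
    Z = ∑arr a k (λ w → f (a ∷ w))
    head-a : ∑arr a k (h a) ≡ Z
    head-a = ∑arr-cong a k (λ w al _ → trans (cong (λ b → 𝟙 (not b) * f (a ∷ w)) (∉-All< a w al)) (ℕP.+-identityʳ (f (a ∷ w))))
    arith : ∀ x y z → (x + y) + (z + 0) ≡ x + (z + y)
    arith x y z rewrite ℕP.+-identityʳ z = trans (ℕP.+-assoc x y z) (cong (x +_) (ℕP.+-comm y z))

  ∑arr-short-alphabet : ∀ a k (f : List ℕ → ℕ) → a < k → ∑arr a k f ≡ 0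
  ∑arr-short-alphabet zero (suc k) f lt = refl
  ∑arr-short-alphabet (suc a) (suc k) f (s≤s lt) = trans (∑arr-split (suc k) a f) (cong₂ _+_ (∑arr-short-alphabet a (suc k) f (ℕP.m<n⇒m<1+n lt)) (∑arr-short-alphabet a k _ lt))

  countᵇ-filterᵇ : {A : Set} (p d : A → Bool) (L : List A) → countᵇ p (filterᵇ d L) ≡ ∑ L (λ x → 𝟙 (d x) * 𝟙 (p x))
  countᵇ-filterᵇ p d [] = refl
  countᵇ-filterᵇ p d (x ∷ L) with d x
  ... | false = countᵇ-filterᵇ p d L
  ... | true with p x
  ... | true = cong suc (countᵇ-filterᵇ p d L)
  ... | false = countᵇ-filterᵇ p d L

  count-perms : ∀ n P → countᵇ P (perms n) ≡ ∑arr n n (λ π → 𝟙 (P π))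
  count-perms n P = countᵇ-filterᵇ P distinct (words n n)

  count-perms-by-insertion : ∀ n P → countᵇ P (perms (suc n)) ≡ ∑arr n n (λ σ → ∑ (upTo (suc n)) (λ p → 𝟙 (P (ins p n σ))))
  count-perms-by-insertion n P = trans (count-perms (suc n) P) (trans (∑arr-split (suc n) n f) (cong (_+ ∑arrWith n (suc n) f) (∑arr-short-alphabet n (suc n) f ℕP.≤-refl)))
    where
    f : List ℕ → ℕ
    f π = 𝟙 (P π)

module Descents where
  open import Defs
  open BoolSets
  open Arrangements using (ins)
  open import Data.Nat as ℕ using (ℕ; zero; suc; _+_; _<_; _≤_; z≤n; s≤s; _≡ᵇ_; _<ᵇ_)
  import Data.Nat.Properties as ℕP
  open import Data.Bool using (Bool; true; false; _∧_; _∨_; if_then_else_)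
  open import Data.Bool.Properties using (∨-identityʳ; ∧-zeroʳ; ∧-identityʳ)
  open import Data.List using (List; []; _∷_; [_]; _++_; length)
  open import Data.List.Relation.Unary.All using (All; []; _∷_)
  open import Relation.Binary.PropositionalEquality hiding ([_])
  open ≡-Reasoning

  isDescent : ℕ → List ℕ → ℕ → Bool
  isDescent i (x ∷ y ∷ xs) z = ((z ≡ᵇ i) ∧ (y <ᵇ x)) ∨ isDescent (suc i) (y ∷ xs) z
  isDescent i _ z = false

  dropsAfter : ℕ → List ℕ → Bool
  dropsAfter y [] = false
  dropsAfter y (h ∷ t) = h <ᵇ y

  isDescent-cons : ∀ i y w z → isDescent i (y ∷ w) z ≡ (((z ≡ᵇ i) ∧ dropsAfter y w) ∨ isDescent (suc i) w z)
  isDescent-cons i y [] z = sym (trans (∨-identityʳ _) (∧-zeroʳ (z ≡ᵇ i)))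
  isDescent-cons i y (h ∷ t) z = refl

  ∈-guarded : ∀ z i c D → z ∈ᵇ ((if c then [ i ] else []) ++ D) ≡ (((z ≡ᵇ i) ∧ c) ∨ (z ∈ᵇ D))
  ∈-guarded z i true D = cong (_∨ (z ∈ᵇ D)) (sym (∧-identityʳ (z ≡ᵇ i)))
  ∈-guarded z i false D = cong (_∨ (z ∈ᵇ D)) (sym (∧-zeroʳ (z ≡ᵇ i)))

  ∈-descentsFrom : ∀ i π z → z ∈ᵇ descentsFrom i π ≡ isDescent i π z
  ∈-descentsFrom i [] z = refl
  ∈-descentsFrom i (x ∷ []) z = refl
  ∈-descentsFrom i (x ∷ y ∷ xs) z = trans (∈-guarded z i (y <ᵇ x) _) (cong (((z ≡ᵇ i) ∧ (y <ᵇ x)) ∨_) (∈-descentsFrom (suc i) (y ∷ xs) z))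

  isDescent-below : ∀ i π z → z < i → isDescent i π z ≡ false
  isDescent-below i [] z lt = refl
  isDescent-below i (x ∷ r) z lt = trans (isDescent-cons i x r z) (cong₂ (λ b c → (b ∧ dropsAfter x r) ∨ c) (≡ᵇ-false (ℕP.<⇒≢ lt)) (isDescent-below (suc i) r z (ℕP.m<n⇒m<1+n lt)))

  isDescent-above : ∀ i π z → i + length π ≤ suc z → isDescent i π z ≡ false
  isDescent-above i [] z le = refl
  isDescent-above i (x ∷ []) z le = refl
  isDescent-above i (x ∷ y ∷ xs) z le = trans (isDescent-cons i x (y ∷ xs) z) (cong₂ (λ b c → (b ∧ (y <ᵇ x)) ∨ c) (≡ᵇ-false (ℕP.>⇒≢ i<z)) (isDescent-above (suc i) (y ∷ xs) z (subst (_≤ suc z) (ℕP.+-suc i _) le)))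
    where
    i+1+len≤z : suc i + length xs ≤ z
    i+1+len≤z = ℕP.≤-pred (subst (_≤ suc z) (trans (ℕP.+-suc i (suc (length xs))) (cong suc (ℕP.+-suc i (length xs)))) le)
    i<z : i < z
    i<z = ℕP.≤-trans (ℕ.s≤s (ℕP.m≤m+n i _)) i+1+len≤z

  isDescent-shift : ∀ i π z → isDescent (suc i) π (suc z) ≡ isDescent i π z
  isDescent-shift i [] z = refl
  isDescent-shift i (x ∷ []) z = refl
  isDescent-shift i (x ∷ y ∷ xs) z = cong (((z ≡ᵇ i) ∧ (y <ᵇ x)) ∨_) (isDescent-shift (suc i) (y ∷ xs) z)

  ins-at-end : ∀ a σ → ins (length σ) a σ ≡ σ ++ [ a ]
  ins-at-end a [] = refl
  ins-at-end a (x ∷ σ) = cong (x ∷_) (ins-at-end a σ)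

  isDescent-snoc-max : ∀ i a σ z → All (_< a) σ → isDescent i (σ ++ [ a ]) z ≡ isDescent i σ z
  isDescent-snoc-max i a [] z al = refl
  isDescent-snoc-max i a (y ∷ []) z (lt ∷ al) = trans (isDescent-cons i y [ a ] z) (trans (cong (λ b → ((z ≡ᵇ i) ∧ b) ∨ false) (<ᵇ-false a y (ℕP.<⇒≤ lt))) (trans (∨-identityʳ _) (∧-zeroʳ (z ≡ᵇ i))))
  isDescent-snoc-max i a (y ∷ h ∷ t) z (lt ∷ al) = cong (((z ≡ᵇ i) ∧ (h <ᵇ y)) ∨_) (isDescent-snoc-max (suc i) a (h ∷ t) z al)

  isDescent-ins-left : ∀ i p a σ z → All (_< a) σ → p ≤ length σ → suc z < i + p → isDescent i (ins p a σ) z ≡ isDescent i σ z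
  isDescent-ins-left i zero a σ z al le lt = trans (isDescent-below i (a ∷ σ) z z<i) (sym (isDescent-below i σ z z<i))
    where
    z<i : z < i
    z<i = ℕP.≤-trans (ℕP.n≤1+n _) (subst (suc z <_) (ℕP.+-identityʳ i) lt)
  isDescent-ins-left i (suc zero) a (y ∷ σ) z (ly ∷ al) le lt = begin
    isDescent i (y ∷ a ∷ σ) z ≡⟨ isDescent-cons i y (a ∷ σ) z ⟩
    ((z ≡ᵇ i) ∧ (a <ᵇ y)) ∨ isDescent (suc i) (a ∷ σ) z ≡⟨ cong₂ (λ b c → (b ∧ (a <ᵇ y)) ∨ c) (≡ᵇ-false (ℕP.<⇒≢ z<i)) (isDescent-below (suc i) (a ∷ σ) z z<i+1) ⟩
    false ≡⟨ sym (cong₂ (λ b c → (b ∧ dropsAfter y σ) ∨ c) (≡ᵇ-false (ℕP.<⇒≢ z<i)) (isDescent-below (suc i) σ z z<i+1)) ⟩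
    ((z ≡ᵇ i) ∧ dropsAfter y σ) ∨ isDescent (suc i) σ z ≡⟨ sym (isDescent-cons i y σ z) ⟩
    isDescent i (y ∷ σ) z ∎
    where
    z<i : z < i
    z<i = ℕP.≤-pred (subst (suc (suc z) ≤_) (ℕP.+-comm i 1) lt)
    z<i+1 : z < suc i
    z<i+1 = ℕP.m<n⇒m<1+n z<i
  isDescent-ins-left i (suc (suc p)) a (y ∷ h ∷ t) z (ly ∷ al) (s≤s le) lt = cong (((z ≡ᵇ i) ∧ (h <ᵇ y)) ∨_) (isDescent-ins-left (suc i) (suc p) a (h ∷ t) z al le (subst (suc z <_) (ℕP.+-suc i (suc p)) lt))

  guard-false : ∀ z i b c → i < z → (((z ≡ᵇ i) ∧ b) ∨ c) ≡ c
  guard-false z i b c lt rewrite ≡ᵇ-false (ℕP.>⇒≢ lt) = refl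

  isDescent-before-max : ∀ i p a σ → All (_< a) σ → suc p ≤ length σ → isDescent i (ins (suc p) a σ) (i + p) ≡ false
  isDescent-before-max i zero a (y ∷ σ) (ly ∷ al) le = trans (isDescent-cons i y (a ∷ σ) (i + 0))
    (trans (cong₂ (λ b c → ((i + 0 ≡ᵇ i) ∧ b) ∨ c) (<ᵇ-false a y (ℕP.<⇒≤ ly)) (isDescent-below (suc i) (a ∷ σ) (i + 0) (s≤s (ℕP.≤-reflexive (ℕP.+-identityʳ i)))))
           (cong (_∨ false) (∧-zeroʳ _)))
  isDescent-before-max i (suc p) a (y ∷ σ) (ly ∷ al) (s≤s le) = trans (isDescent-cons i y (ins (suc p) a σ) (i + suc p))
    (trans (guard-false (i + suc p) i _ _ (ℕP.m<m+n i (s≤s z≤n)))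
       (subst (λ t → isDescent (suc i) (ins (suc p) a σ) t ≡ false) (sym (ℕP.+-suc i p)) (isDescent-before-max (suc i) p a σ al le)))

  isDescent-after-max : ∀ i p a σ → All (_< a) σ → p ≤ length σ → isDescent i (ins p a σ) (i + p) ≡ (p <ᵇ length σ)
  isDescent-after-max i zero a σ al le rewrite ℕP.+-identityʳ i = trans (isDescent-cons i a σ i) (trans (cong₂ (λ b c → (b ∧ dropsAfter a σ) ∨ c) (≡ᵇ-refl i) (isDescent-below (suc i) σ i (ℕP.n<1+n i))) (trans (∨-identityʳ _) (drops σ al)))
    where
    drops : ∀ σ → All (_< a) σ → dropsAfter a σ ≡ (0 <ᵇ length σ)
    drops [] _ = refl
    drops (x ∷ σ) (x<a ∷ _) = <ᵇ-true x a x<a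
  isDescent-after-max i (suc p) a (y ∷ σ) (ly ∷ al) (s≤s le) = trans (isDescent-cons i y (ins p a σ) (i + suc p))
    (trans (guard-false (i + suc p) i _ _ (ℕP.m<m+n i (s≤s z≤n)))
       (subst (λ t → isDescent (suc i) (ins p a σ) t ≡ (p <ᵇ length σ)) (sym (ℕP.+-suc i p)) (isDescent-after-max (suc i) p a σ al le)))

  isDescent-ins-right : ∀ i p k a σ → All (_< a) σ → p ≤ length σ → isDescent i (ins p a σ) (suc (i + p + k)) ≡ isDescent i σ (i + p + k)
  isDescent-ins-right i zero k a σ al le = trans (isDescent-cons i a σ (suc (i + 0 + k))) (trans (guard-false (suc (i + 0 + k)) i _ _ (s≤s (ℕP.≤-trans (ℕP.m≤m+n i 0) (ℕP.m≤m+n (i + 0) k)))) (isDescent-shift i σ (i + 0 + k)))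
  isDescent-ins-right i (suc p) k a (y ∷ σ) (ly ∷ al) (s≤s le) = begin
    isDescent i (y ∷ ins p a σ) (suc (i + suc p + k)) ≡⟨ isDescent-cons i y (ins p a σ) _ ⟩
    (((suc (i + suc p + k)) ≡ᵇ i) ∧ dropsAfter y (ins p a σ)) ∨ isDescent (suc i) (ins p a σ) (suc (i + suc p + k)) ≡⟨ guard-false _ i _ _ (s≤s (ℕP.≤-trans (ℕP.m≤m+n i (suc p)) (ℕP.m≤m+n (i + suc p) k))) ⟩
    isDescent (suc i) (ins p a σ) (suc (i + suc p + k)) ≡⟨ cong (λ t → isDescent (suc i) (ins p a σ) (suc t)) reindex ⟩
    isDescent (suc i) (ins p a σ) (suc (suc i + p + k)) ≡⟨ isDescent-ins-right (suc i) p k a σ al le ⟩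
    isDescent (suc i) σ (suc i + p + k) ≡⟨ cong (isDescent (suc i) σ) (sym reindex) ⟩
    isDescent (suc i) σ (i + suc p + k) ≡⟨ sym (guard-false _ i (dropsAfter y σ) _ (ℕP.≤-trans (ℕP.m<m+n i (s≤s z≤n)) (ℕP.m≤m+n (i + suc p) k))) ⟩
    (((i + suc p + k) ≡ᵇ i) ∧ dropsAfter y σ) ∨ isDescent (suc i) σ (i + suc p + k) ≡⟨ sym (isDescent-cons i y σ _) ⟩
    isDescent i (y ∷ σ) (i + suc p + k) ∎
    where
    reindex : i + suc p + k ≡ suc i + p + k
    reindex = cong (_+ k) (ℕP.+-suc i p)

-- Inserting the largest letter n into a permutation
-- σ of {0,…,n-1} at position p creates a descent at p+1 (unless p = n), none
-- at p, and shifts the descents to its right; comparing descent sets gives,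
-- for every finite J,
--   d(J, n+1) = d(J, n) + Σ_{p < n, p+1 ∈ J, p ∉ J} ([p ≠ 0] d(shiftAt J (p+1), n)
--                                                   + d(deleteAt J (p+1), n)),
-- where shiftAt/deleteAt are the value-indexed versions of the paper's I_t, Î_t.
module DescentRecurrence where
  open import Defs
  open BoolSets
  open FiniteSums
  open Arrangements
  open Descents
  open import Data.Nat using (ℕ; zero; suc; pred; _+_; _*_; _<_; _≤_; z≤n; s≤s; _≡ᵇ_; _<ᵇ_; _≤ᵇ_)
  import Data.Nat.Properties as ℕP
  open import Data.Bool using (Bool; true; false; not; _∧_; _∨_)
  open import Data.Bool.Properties using (∨-identityʳ; ∧-zeroʳ)
  open import Data.List using (List; []; _++_; map; length; filterᵇ; upTo)
  open import Data.List.Relation.Unary.All using (All)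
  open import Data.Product using (_×_; _,_; proj₁; proj₂)
  open import Data.Sum using (_⊎_; inj₁; inj₂)
  open import Data.Nat.Solver using (module +-*-Solver)
  open +-*-Solver using (solve; _:=_; _:+_; _:*_)
  open import Relation.Binary.PropositionalEquality hiding ([_])
  open ≡-Reasoning

  -- For x = i_t ∈ J: shiftAt J x = J_t (elements ≥ x lowered by one, 0
  -- removed) and deleteAt J x = Ĵ_t (x removed, larger elements lowered).
  shiftAt : List ℕ → ℕ → List ℕ
  shiftAt J x = filterᵇ (λ z → z <ᵇ x) J ++ filterᵇ (λ z → not (z ≡ᵇ 0)) (map pred (filterᵇ (λ z → x ≤ᵇ z) J))

  deleteAt : List ℕ → ℕ → List ℕ
  deleteAt J x = filterᵇ (λ z → z <ᵇ x) J ++ map pred (filterᵇ (λ z → x <ᵇ z) J)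

  ∈-shiftAt : ∀ J p z → z ∈ᵇ shiftAt J (suc p) ≡ (((z <ᵇ suc p) ∧ (z ∈ᵇ J)) ∨ (not (z ≡ᵇ 0) ∧ ((p <ᵇ suc z) ∧ (suc z ∈ᵇ J))))
  ∈-shiftAt J p z rewrite ∈ᵇ-++ z (filterᵇ (λ z → z <ᵇ suc p) J) (filterᵇ (λ z → not (z ≡ᵇ 0)) (map pred (filterᵇ (λ z → suc p ≤ᵇ z) J)))
    | ∈-filter (λ z → z <ᵇ suc p) J z | ∈-filter (λ z → not (z ≡ᵇ 0)) (map pred (filterᵇ (λ z → suc p ≤ᵇ z) J)) z
    | ∈-map-pred (filterᵇ (λ z → suc p ≤ᵇ z) J) z | ∈-filter (λ z → suc p ≤ᵇ z) J (suc z) | ∈-filter (λ z → suc p ≤ᵇ z) J 0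
    = cong (((z <ᵇ suc p) ∧ (z ∈ᵇ J)) ∨_) (cong (not (z ≡ᵇ 0) ∧_) (trans (cong (((p <ᵇ suc z) ∧ (suc z ∈ᵇ J)) ∨_) (∧-zeroʳ (z ≡ᵇ 0))) (∨-identityʳ _)))

  ∈-deleteAt : ∀ J p z → z ∈ᵇ deleteAt J (suc p) ≡ (((z <ᵇ suc p) ∧ (z ∈ᵇ J)) ∨ ((suc p <ᵇ suc z) ∧ (suc z ∈ᵇ J)))
  ∈-deleteAt J p z rewrite ∈ᵇ-++ z (filterᵇ (λ z → z <ᵇ suc p) J) (map pred (filterᵇ (λ z → suc p <ᵇ z) J))
    | ∈-filter (λ z → z <ᵇ suc p) J z
    | ∈-map-pred (filterᵇ (λ z → suc p <ᵇ z) J) z | ∈-filter (λ z → suc p <ᵇ z) J (suc z) | ∈-filter (λ z → suc p <ᵇ z) J 0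
    = cong (((z <ᵇ suc p) ∧ (z ∈ᵇ J)) ∨_) (trans (cong (((suc p <ᵇ suc z) ∧ (suc z ∈ᵇ J)) ∨_) (∧-zeroʳ (z ≡ᵇ 0))) (∨-identityʳ _))

  shiftAt-below : ∀ J p z → z < p → z ∈ᵇ shiftAt J (suc p) ≡ z ∈ᵇ J
  shiftAt-below J p z lt rewrite ∈-shiftAt J p z | <ᵇ-true _ _ (ℕP.m<n⇒m<1+n lt) | <ᵇ-false p (suc z) lt | ∧-zeroʳ (not (z ≡ᵇ 0)) = ∨-identityʳ _

  shiftAt-at : ∀ J p → p ∈ᵇ shiftAt J (suc p) ≡ ((p ∈ᵇ J) ∨ (not (p ≡ᵇ 0) ∧ (suc p ∈ᵇ J)))
  shiftAt-at J p rewrite ∈-shiftAt J p p | <ᵇ-true _ _ (ℕP.n<1+n p) = refl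

  shiftAt-above : ∀ J p k → suc (p + k) ∈ᵇ shiftAt J (suc p) ≡ suc (suc (p + k)) ∈ᵇ J
  shiftAt-above J p k rewrite ∈-shiftAt J p (suc (p + k)) | <ᵇ-false (suc (p + k)) (suc p) (s≤s (ℕP.m≤m+n p k)) | <ᵇ-true p (suc (suc (p + k))) (s≤s (ℕP.≤-trans (ℕP.m≤m+n p k) (ℕP.n≤1+n _))) = refl

  deleteAt-below : ∀ J p z → z < p → z ∈ᵇ deleteAt J (suc p) ≡ z ∈ᵇ J
  deleteAt-below J p z lt rewrite ∈-deleteAt J p z | <ᵇ-true _ _ (ℕP.m<n⇒m<1+n lt) | <ᵇ-false p z (ℕP.<⇒≤ lt) = ∨-identityʳ _

  deleteAt-at : ∀ J p → p ∈ᵇ deleteAt J (suc p) ≡ p ∈ᵇ J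
  deleteAt-at J p rewrite ∈-deleteAt J p p | <ᵇ-true _ _ (ℕP.n<1+n p) | <ᵇ-false p p ℕP.≤-refl = ∨-identityʳ _

  deleteAt-above : ∀ J p k → suc (p + k) ∈ᵇ deleteAt J (suc p) ≡ suc (suc (p + k)) ∈ᵇ J
  deleteAt-above J p k rewrite ∈-deleteAt J p (suc (p + k)) | <ᵇ-false (suc (p + k)) (suc p) (s≤s (ℕP.m≤m+n p k)) | <ᵇ-true p (suc (p + k)) (s≤s (ℕP.m≤m+n p k)) = refl

  shiftAt-members : ∀ J p z → z ∈ᵇ shiftAt J (suc p) ≡ true → ((z ∈ᵇ J ≡ true) × (z ≤ p)) ⊎ (suc z ∈ᵇ J ≡ true)
  shiftAt-members J p z z∈ with ∨-true {(z <ᵇ suc p) ∧ (z ∈ᵇ J)} (trans (sym (∈-shiftAt J p z)) z∈)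
  ... | inj₁ e = inj₁ (∧-true₂ {z <ᵇ suc p} e , ℕP.≤-pred (<ᵇ-sound z (suc p) (∧-true₁ e)))
  ... | inj₂ e = inj₂ (∧-true₂ {p <ᵇ suc z} (∧-true₂ {not (z ≡ᵇ 0)} e))

  deleteAt-members : ∀ J p z → z ∈ᵇ deleteAt J (suc p) ≡ true → ((z ∈ᵇ J ≡ true) × (z ≤ p)) ⊎ (suc z ∈ᵇ J ≡ true)
  deleteAt-members J p z z∈ with ∨-true {(z <ᵇ suc p) ∧ (z ∈ᵇ J)} (trans (sym (∈-deleteAt J p z)) z∈)
  ... | inj₁ e = inj₁ (∧-true₂ {z <ᵇ suc p} e , ℕP.≤-pred (<ᵇ-sound z (suc p) (∧-true₁ e)))
  ... | inj₂ e = inj₂ (∧-true₂ {suc p <ᵇ suc z} e)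

  shiftAt-below-bound : ∀ J p B → (∀ z → z ∈ᵇ J ≡ true → z < suc B) → suc p ∈ᵇ J ≡ true →
                        ∀ z → z ∈ᵇ shiftAt J (suc p) ≡ true → z < B
  shiftAt-below-bound J p B J<B p+1∈J z z∈ with shiftAt-members J p z z∈
  ... | inj₁ (_ , z≤p) = ℕP.≤-<-trans z≤p (ℕP.≤-pred (J<B (suc p) p+1∈J))
  ... | inj₂ z+1∈J = ℕP.≤-pred (J<B (suc z) z+1∈J)

  deleteAt-below-bound : ∀ J p B → (∀ z → z ∈ᵇ J ≡ true → z < suc B) → suc p ∈ᵇ J ≡ true →
                         ∀ z → z ∈ᵇ deleteAt J (suc p) ≡ true → z < B
  deleteAt-below-bound J p B J<B p+1∈J z z∈ with deleteAt-members J p z z∈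
  ... | inj₁ (_ , z≤p) = ℕP.≤-<-trans z≤p (ℕP.≤-pred (J<B (suc p) p+1∈J))
  ... | inj₂ z+1∈J = ℕP.≤-pred (J<B (suc z) z+1∈J)

  shiftAt-positive : ∀ J p → 0 ∈ᵇ J ≡ false → 0 ∈ᵇ shiftAt J (suc p) ≡ false
  shiftAt-positive J p 0∉J rewrite ∈-shiftAt J p 0 | 0∉J = refl

  deleteAt-positive : ∀ J p → 0 ∈ᵇ J ≡ false → 0 ∈ᵇ deleteAt J (suc p) ≡ false
  deleteAt-positive J p 0∉J rewrite ∈-deleteAt J p 0 | 0∉J = refl

  boundary : List ℕ → ℕ → ℕ
  boundary J p = 𝟙 ((suc p ∈ᵇ J) ∧ not (p ∈ᵇ J))

  nonzero : ℕ → ℕ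
  nonzero p = 𝟙 (not (p ≡ᵇ 0))

  recTerm : List ℕ → ℕ → (List ℕ → ℕ) → ℕ
  recTerm J p c = boundary J p * (nonzero p * c (shiftAt J (suc p)) + c (deleteAt J (suc p)))

  recTerm-+ : ∀ J p f g → recTerm J p (λ X → f X + g X) ≡ recTerm J p f + recTerm J p g
  recTerm-+ J p f g = solve 6 (λ b z fS fH gS gH → b :* (z :* (fS :+ gS) :+ (fH :+ gH)) := b :* (z :* fS :+ fH) :+ b :* (z :* gS :+ gH)) refl
    (boundary J p) (nonzero p) (f (shiftAt J (suc p))) (f (deleteAt J (suc p))) (g (shiftAt J (suc p))) (g (deleteAt J (suc p)))

  recTerm-scalar : ∀ J p c f → recTerm J p (λ X → c * f X) ≡ c * recTerm J p f
  recTerm-scalar J p c f = solve 5 (λ b z c fS fH → b :* (z :* (c :* fS) :+ c :* fH) := c :* (b :* (z :* fS :+ fH))) refl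
    (boundary J p) (nonzero p) c (f (shiftAt J (suc p))) (f (deleteAt J (suc p)))

  recTerm-cong : ∀ J p {f g} → (suc p ∈ᵇ J ≡ true → f (shiftAt J (suc p)) ≡ g (shiftAt J (suc p)) × f (deleteAt J (suc p)) ≡ g (deleteAt J (suc p))) →
                 recTerm J p f ≡ recTerm J p g
  recTerm-cong J p {f} {g} agree with suc p ∈ᵇ J in p+1∈J
  ... | false = refl
  ... | true = cong₂ (λ u v → 𝟙 (not (p ∈ᵇ J)) * (nonzero p * u + v)) (proj₁ (agree refl)) (proj₂ (agree refl))

  recTerm-off : ∀ J p f → boundary J p ≡ 0 → recTerm J p f ≡ 0
  recTerm-off J p f off = cong (λ b → b * (nonzero p * f (shiftAt J (suc p)) + f (deleteAt J (suc p)))) off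

  hasDescent : List ℕ → ℕ → Bool
  hasDescent π z = z ∈ᵇ descentSet π

  hasDescentSet : List ℕ → List ℕ → Bool
  hasDescentSet J π = sameSet (descentSet π) J

  module InsertMax (n : ℕ) (σ : List ℕ) (σ<n : All (_< n) σ) (len : length σ ≡ n) (p : ℕ) (p<n : p < n) where
    π : List ℕ
    π = ins p n σ

    p≤len : p ≤ length σ
    p≤len = subst (p ≤_) (sym len) (ℕP.<⇒≤ p<n)

    left-unchanged : ∀ z → z < p → hasDescent π z ≡ hasDescent σ z
    left-unchanged z lt = trans (∈-descentsFrom 1 π z) (trans (isDescent-ins-left 1 p n σ z σ<n p≤len (s≤s lt)) (sym (∈-descentsFrom 1 σ z)))

    no-descent-before : hasDescent π p ≡ false
    no-descent-before = trans (∈-descentsFrom 1 π p) (at p p≤len)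
      where
      at : ∀ q → q ≤ length σ → isDescent 1 (ins q n σ) q ≡ false
      at zero _ = isDescent-below 1 (ins 0 n σ) 0 (s≤s z≤n)
      at (suc q) le = isDescent-before-max 1 q n σ σ<n le

    descent-after : hasDescent π (suc p) ≡ true
    descent-after = trans (∈-descentsFrom 1 π (suc p)) (trans (isDescent-after-max 1 p n σ σ<n p≤len) (<ᵇ-true p (length σ) (subst (p <_) (sym len) p<n)))

    right-shifted : ∀ k → hasDescent π (suc (suc (p + k))) ≡ hasDescent σ (suc (p + k))
    right-shifted k = trans (∈-descentsFrom 1 π _) (trans (isDescent-ins-right 1 p k n σ σ<n p≤len) (sym (∈-descentsFrom 1 σ _)))

    no-descent-at-0 : hasDescent σ 0 ≡ false
    no-descent-at-0 = trans (∈-descentsFrom 1 σ 0) (isDescent-below 1 σ 0 (s≤s z≤n))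

    descent-sets-correspond : ∀ J X → (suc p ∈ᵇ J) ≡ true → (p ∈ᵇ J) ≡ false →
             (∀ z → z < p → z ∈ᵇ X ≡ z ∈ᵇ J) → (p ∈ᵇ X ≡ hasDescent σ p) →
             (∀ k → suc (p + k) ∈ᵇ X ≡ suc (suc (p + k)) ∈ᵇ J) →
             hasDescentSet J π ≡ hasDescentSet X σ
    descent-sets-correspond J X p+1∈J p∉J below at above = bool-ext fwd bwd
      where
      fwd : hasDescentSet J π ≡ true → hasDescentSet X σ ≡ true
      fwd e = sameSet-complete (descentSet σ) X same
        where
        π≈J : ∀ z → hasDescent π z ≡ z ∈ᵇ J
        π≈J = sameSet-sound (descentSet π) J e
        same : ∀ z → hasDescent σ z ≡ z ∈ᵇ X
        same z with trichotomy z p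
        ... | inj₁ lt = trans (sym (left-unchanged z lt)) (trans (π≈J z) (sym (below z lt)))
        ... | inj₂ (inj₁ refl) = sym at
        ... | inj₂ (inj₂ (k , refl)) = trans (sym (right-shifted k)) (trans (π≈J (suc (suc (p + k)))) (sym (above k)))
      bwd : hasDescentSet X σ ≡ true → hasDescentSet J π ≡ true
      bwd e = sameSet-complete (descentSet π) J same
        where
        σ≈X : ∀ z → hasDescent σ z ≡ z ∈ᵇ X
        σ≈X = sameSet-sound (descentSet σ) X e
        same : ∀ z → hasDescent π z ≡ z ∈ᵇ J
        same z with trichotomy z p
        ... | inj₁ lt = trans (left-unchanged z lt) (trans (σ≈X z) (below z lt))
        ... | inj₂ (inj₁ refl) = trans no-descent-before (sym p∉J)
        ... | inj₂ (inj₂ (zero , refl)) = trans (cong (λ t → hasDescent π (suc t)) (ℕP.+-identityʳ p)) (trans descent-after (trans (sym p+1∈J) (cong (λ t → suc t ∈ᵇ J) (sym (ℕP.+-identityʳ p)))))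
        ... | inj₂ (inj₂ (suc k , refl)) = trans (cong (λ t → hasDescent π (suc t)) (ℕP.+-suc p k)) (trans (right-shifted k) (trans (σ≈X (suc (p + k))) (trans (above k) (cong (λ t → suc t ∈ᵇ J) (sym (ℕP.+-suc p k))))))

    descent-at-p : ∀ J → (suc p ∈ᵇ J) ≡ true → (p ∈ᵇ J) ≡ false → hasDescent σ p ≡ true →
      𝟙 (hasDescentSet J π) ≡ nonzero p * 𝟙 (hasDescentSet (shiftAt J (suc p)) σ) + 𝟙 (hasDescentSet (deleteAt J (suc p)) σ)
    descent-at-p J p+1∈J p∉J desc = begin
      𝟙 (hasDescentSet J π)
        ≡⟨ cong 𝟙 (descent-sets-correspond J S p+1∈J p∉J (shiftAt-below J p) (trans p∈shift (sym desc)) (shiftAt-above J p)) ⟩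
      𝟙 (hasDescentSet S σ)
        ≡⟨ sym (trans (ℕP.+-identityʳ _) (ℕP.*-identityˡ _)) ⟩
      1 * 𝟙 (hasDescentSet S σ) + 0
        ≡⟨ sym (cong₂ (λ u v → u * 𝟙 (hasDescentSet S σ) + v) (cong (λ b → 𝟙 (not b)) p≢0) (cong 𝟙 deleted-rejected)) ⟩
      nonzero p * 𝟙 (hasDescentSet S σ) + 𝟙 (hasDescentSet (deleteAt J (suc p)) σ) ∎
      where
      S : List ℕ
      S = shiftAt J (suc p)
      p≢0 : (p ≡ᵇ 0) ≡ false
      p≢0 = not-true (λ e → true≢false (trans (sym desc) (trans (cong (hasDescent σ) (≡ᵇ-true p 0 e)) no-descent-at-0)))
      p∈shift : p ∈ᵇ shiftAt J (suc p) ≡ true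
      p∈shift rewrite shiftAt-at J p | p∉J | p≢0 | p+1∈J = refl
      deleted-rejected : hasDescentSet (deleteAt J (suc p)) σ ≡ false
      deleted-rejected = sameSet-false (descentSet σ) (deleteAt J (suc p)) p desc (trans (deleteAt-at J p) p∉J)

    no-descent-at-p : ∀ J → (suc p ∈ᵇ J) ≡ true → (p ∈ᵇ J) ≡ false → hasDescent σ p ≡ false →
      𝟙 (hasDescentSet J π) ≡ nonzero p * 𝟙 (hasDescentSet (shiftAt J (suc p)) σ) + 𝟙 (hasDescentSet (deleteAt J (suc p)) σ)
    no-descent-at-p J p+1∈J p∉J nodesc = begin
      𝟙 (hasDescentSet J π)
        ≡⟨ cong 𝟙 (descent-sets-correspond J H p+1∈J p∉J (deleteAt-below J p) (trans (trans (deleteAt-at J p) p∉J) (sym nodesc)) (deleteAt-above J p)) ⟩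
      𝟙 (hasDescentSet H σ)
        ≡⟨ cong (_+ 𝟙 (hasDescentSet H σ)) (sym shifted-rejected) ⟩
      nonzero p * 𝟙 (hasDescentSet (shiftAt J (suc p)) σ) + 𝟙 (hasDescentSet H σ) ∎
      where
      H : List ℕ
      H = deleteAt J (suc p)
      p∈shift : (p ≡ᵇ 0) ≡ false → p ∈ᵇ shiftAt J (suc p) ≡ true
      p∈shift p≢0 rewrite shiftAt-at J p | p∉J | p≢0 | p+1∈J = refl
      shifted-rejected : nonzero p * 𝟙 (hasDescentSet (shiftAt J (suc p)) σ) ≡ 0
      shifted-rejected with p ≡ᵇ 0 in p≟0
      ... | true = refl
      ... | false rewrite sameSet-false' (descentSet σ) (shiftAt J (suc p)) p nodesc (p∈shift p≟0) = refl

    insertion-indicator : ∀ J → 𝟙 (hasDescentSet J π) ≡ recTerm J p (λ K → 𝟙 (hasDescentSet K σ))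
    insertion-indicator J with suc p ∈ᵇ J in p+1∈J
    ... | false = cong 𝟙 (sameSet-false (descentSet π) J (suc p) descent-after p+1∈J)
    ... | true with p ∈ᵇ J in p∈J
    ... | true = cong 𝟙 (sameSet-false' (descentSet π) J p no-descent-before p∈J)
    ... | false with hasDescent σ p in desc
    ... | true = trans (descent-at-p J p+1∈J p∈J desc) (sym (ℕP.+-identityʳ _))
    ... | false = trans (no-descent-at-p J p+1∈J p∈J desc) (sym (ℕP.+-identityʳ _))

  insert-at-end : ∀ n σ → All (_< n) σ → length σ ≡ n → ∀ J → hasDescentSet J (ins n n σ) ≡ hasDescentSet J σ
  insert-at-end n σ al len J = sameSet-resp (descentSet (ins n n σ)) (descentSet σ) J J mem (λ _ → refl)
    where
    mem : ∀ z → z ∈ᵇ descentSet (ins n n σ) ≡ z ∈ᵇ descentSet σ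
    mem z = trans (∈-descentsFrom 1 (ins n n σ) z) (trans (cong (λ t → isDescent 1 (ins t n σ) z) (sym len))
              (trans (cong (λ l → isDescent 1 l z) (ins-at-end n σ)) (trans (isDescent-snoc-max 1 n σ z al) (sym (∈-descentsFrom 1 σ z)))))

  descent-recurrence : ∀ J n → dcount J (suc n) ≡ ∑ (upTo n) (λ p → recTerm J p (λ K → dcount K n)) + dcount J n
  descent-recurrence J n = begin
    dcount J (suc n)
      ≡⟨ count-perms-by-insertion n (hasDescentSet J) ⟩
    ∑arr n n (λ σ → ∑ (upTo (suc n)) (λ p → 𝟙 (hasDescentSet J (ins p n σ))))
      ≡⟨ ∑arr-cong n n (λ σ σ<n len → trans (∑-upTo-suc n _) (cong₂ _+_ (∑-upTo-cong n (λ p p<n → InsertMax.insertion-indicator n σ σ<n len p p<n J)) (cong 𝟙 (insert-at-end n σ σ<n len J)))) ⟩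
    ∑arr n n (λ σ → ∑ (upTo n) (λ p → recTerm J p (indicator σ)) + 𝟙 (hasDescentSet J σ))
      ≡⟨ ∑arr-+ n n _ _ ⟩
    ∑arr n n (λ σ → ∑ (upTo n) (λ p → recTerm J p (indicator σ))) + ∑arr n n (λ σ → 𝟙 (hasDescentSet J σ))
      ≡⟨ cong₂ _+_ (∑arr-swap n n (upTo n) _) (sym (count-perms n (hasDescentSet J))) ⟩
    ∑ (upTo n) (λ p → ∑arr n n (λ σ → recTerm J p (indicator σ))) + dcount J n
      ≡⟨ cong (_+ dcount J n) (∑-cong (upTo n) summed) ⟩
    ∑ (upTo n) (λ p → recTerm J p (λ K → dcount K n)) + dcount J n ∎
    where
    indicator : List ℕ → List ℕ → ℕ
    indicator σ K = 𝟙 (hasDescentSet K σ)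
    summed : ∀ p → ∑arr n n (λ σ → recTerm J p (indicator σ)) ≡ recTerm J p (λ K → dcount K n)
    summed p = begin
      ∑arr n n (λ σ → b * (z * indicator σ S + indicator σ H))
        ≡⟨ ∑arr-scalar n n b _ ⟩
      b * ∑arr n n (λ σ → z * indicator σ S + indicator σ H)
        ≡⟨ cong (b *_) (∑arr-+ n n _ _) ⟩
      b * (∑arr n n (λ σ → z * indicator σ S) + ∑arr n n (λ σ → indicator σ H))
        ≡⟨ cong (λ t → b * (t + ∑arr n n (λ σ → indicator σ H))) (∑arr-scalar n n z (λ σ → indicator σ S)) ⟩
      b * (z * ∑arr n n (λ σ → indicator σ S) + ∑arr n n (λ σ → indicator σ H))
        ≡⟨ cong₂ (λ u v → b * (z * u + v)) (sym (count-perms n (hasDescentSet S))) (sym (count-perms n (hasDescentSet H))) ⟩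
      b * (z * dcount S n + dcount H n) ∎
      where
      b z : ℕ
      b = boundary J p
      z = nonzero p
      S H : List ℕ
      S = shiftAt J (suc p)
      H = deleteAt J (suc p)

  dcount-resp : ∀ J J' → (∀ z → z ∈ᵇ J ≡ z ∈ᵇ J') → ∀ n → dcount J n ≡ dcount J' n
  dcount-resp J J' h n = trans (count-perms n _) (trans (∑arr-congf n n (λ π → cong 𝟙 (sameSet-resp (descentSet π) (descentSet π) J J' (λ _ → refl) h))) (sym (count-perms n _)))

  dcount-too-short : ∀ J z n → z ∈ᵇ J ≡ true → n ≤ z → dcount J n ≡ 0
  dcount-too-short J z n z∈J n≤z =
    trans (count-perms n _) (∑arr-zero n n _ (λ σ _ len → cong 𝟙 (sameSet-false' (descentSet σ) J z (z∉descents σ len) z∈J)))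
    where
    z∉descents : ∀ σ → length σ ≡ n → z ∈ᵇ descentSet σ ≡ false
    z∉descents σ len = trans (∈-descentsFrom 1 σ z) (isDescent-above 1 σ z (s≤s (subst (_≤ z) (sym len) n≤z)))

  dcount-empty : ∀ n → dcount [] n ≡ 1
  dcount-empty zero = refl
  dcount-empty (suc n) = trans (descent-recurrence [] n) (trans (cong (_+ dcount [] n) (∑-zero (upTo n) (λ _ → refl))) (dcount-empty n))

  dcount-no-descents : ∀ K → (∀ z → z ∈ᵇ K ≡ false) → ∀ n → dcount K n ≡ 1
  dcount-no-descents K none n = trans (dcount-resp K [] none n) (dcount-empty n)

-- For K ⊆ [1, a-1] and n ≥ a,
--   [a ≠ 0]·d(K ∪ {a}, n) + d(K, n) = d(K, a) · C(n, a):
-- both sides count the permutations of [n] whose descents in [1, a-1] form K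
-- and which have no descent after position a (choose the set of the first a
-- values, arrange it with descent set K, and sort the rest).  We prove it by
-- induction on a and n from the descent recurrence, after working out how
-- the recurrence for K ∪ {a} relates to the one for K.
module Shuffle where
  open import Defs
  open BoolSets
  open FiniteSums
  open DescentRecurrence
  open import Data.Nat as ℕ using (ℕ; zero; suc; _+_; _*_; _<_; _≤_; z≤n; s≤s; _≡ᵇ_; _<ᵇ_)
  import Data.Nat.Properties as ℕP
  open import Data.Nat.Combinatorics using (_C_; nCn≡1; nCk+nC[k+1]≡[n+1]C[k+1])
  open import Data.Nat.Solver using (module +-*-Solver)
  open +-*-Solver using (solve; _:=_; _:+_; _:*_; con)
  open import Data.Bool using (true; false; not; _∧_; _∨_)
  open import Data.Bool.Properties using (∨-identityʳ; ∨-zeroʳ; ∧-zeroʳ)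
  open import Data.List using (List; [_]; _++_; upTo)
  open import Data.Product using (_,_)
  open import Data.Sum using (inj₁; inj₂)
  open import Relation.Binary.PropositionalEquality hiding ([_])
  open ≡-Reasoning

  shuffleCount : List ℕ → ℕ → ℕ → ℕ
  shuffleCount K a n = nonzero a * dcount (K ++ [ a ]) n + dcount K n

  module AppendTop (K : List ℕ) (a' : ℕ) (K<a : ∀ z → z ∈ᵇ K ≡ true → z < suc a') where
    a : ℕ
    a = suc a'

    Ka : List ℕ
    Ka = K ++ [ a ]

    ∉K-from-a : ∀ z → a ≤ z → z ∈ᵇ K ≡ false
    ∉K-from-a z a≤z = not-true (λ z∈K → ℕP.<-irrefl refl (ℕP.<-≤-trans (K<a z z∈K) a≤z))

    shift-below-top : ∀ p → p < a' → ∀ z → z ∈ᵇ shiftAt Ka (suc p) ≡ z ∈ᵇ (shiftAt K (suc p) ++ [ a' ])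
    shift-below-top p p<a' z with dichotomy z p
    ... | inj₁ z≤p rewrite ∈-shiftAt Ka p z | ∈-snoc-other z K a (ℕP.<⇒≢ (ℕP.≤-<-trans z≤p (ℕP.m<n⇒m<1+n p<a')))
          | ∈-snoc-other (suc z) K a (ℕP.<⇒≢ (s≤s (ℕP.≤-<-trans z≤p p<a')))
          | ∈-snoc-other z (shiftAt K (suc p)) a' (ℕP.<⇒≢ (ℕP.≤-<-trans z≤p p<a')) | ∈-shiftAt K p z = refl
    ... | inj₂ (k , refl) rewrite ∈-shiftAt Ka p (suc (p + k)) | ∈ᵇ-++ (suc (p + k)) (shiftAt K (suc p)) [ a' ] | ∈-shiftAt K p (suc (p + k))
          | <ᵇ-false (suc (p + k)) (suc p) (s≤s (ℕP.m≤m+n p k)) | <ᵇ-true p (suc (suc (p + k))) (s≤s (ℕP.≤-trans (ℕP.m≤m+n p k) (ℕP.n≤1+n _)))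
          | ∈ᵇ-++ (suc (suc (p + k))) K [ a ] = refl

    delete-below-top : ∀ p → p < a' → ∀ z → z ∈ᵇ deleteAt Ka (suc p) ≡ z ∈ᵇ (deleteAt K (suc p) ++ [ a' ])
    delete-below-top p p<a' z with dichotomy z p
    ... | inj₁ z≤p rewrite ∈-deleteAt Ka p z | ∈-snoc-other z K a (ℕP.<⇒≢ (ℕP.≤-<-trans z≤p (ℕP.m<n⇒m<1+n p<a')))
          | ∈-snoc-other (suc z) K a (ℕP.<⇒≢ (s≤s (ℕP.≤-<-trans z≤p p<a')))
          | ∈-snoc-other z (deleteAt K (suc p)) a' (ℕP.<⇒≢ (ℕP.≤-<-trans z≤p p<a')) | ∈-deleteAt K p z = refl
    ... | inj₂ (k , refl) rewrite ∈-deleteAt Ka p (suc (p + k)) | ∈ᵇ-++ (suc (p + k)) (deleteAt K (suc p)) [ a' ] | ∈-deleteAt K p (suc (p + k))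
          | <ᵇ-false (suc (p + k)) (suc p) (s≤s (ℕP.m≤m+n p k)) | <ᵇ-true p (suc (p + k)) (s≤s (ℕP.m≤m+n p k))
          | ∈ᵇ-++ (suc (suc (p + k))) K [ a ] = refl

    shift-at-top : 0 < a' → ∀ z → z ∈ᵇ shiftAt Ka a ≡ z ∈ᵇ (K ++ [ a' ])
    shift-at-top 0<a' z with trichotomy z a'
    ... | inj₁ z<a' rewrite ∈-shiftAt Ka a' z | <ᵇ-true z a (ℕP.m<n⇒m<1+n z<a') | <ᵇ-false a' (suc z) z<a'
          | ∈-snoc-other z K a (ℕP.<⇒≢ (ℕP.m<n⇒m<1+n z<a')) | ∈-snoc-other z K a' (ℕP.<⇒≢ z<a') | ∧-zeroʳ (not (z ≡ᵇ 0)) = ∨-identityʳ _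
    ... | inj₂ (inj₁ refl) rewrite ∈-shiftAt Ka a' a' | <ᵇ-true a' a (ℕP.n<1+n a') | ≡ᵇ-false {a'} {0} (ℕP.>⇒≢ 0<a')
          | ∈-snoc-self K a | ∈-snoc-self K a' = ∨-zeroʳ _
    ... | inj₂ (inj₂ (k , refl)) rewrite ∈-shiftAt Ka a' (suc (a' + k)) | <ᵇ-false (suc (a' + k)) a (s≤s (ℕP.m≤m+n a' k))
          | ∈-snoc-other (suc (suc (a' + k))) K a (ℕP.>⇒≢ (s≤s (s≤s (ℕP.m≤m+n a' k))))
          | ∈-snoc-other (suc (a' + k)) K a' (ℕP.>⇒≢ (s≤s (ℕP.m≤m+n a' k)))
          | ∉K-from-a (suc (suc (a' + k))) (s≤s (ℕP.≤-trans (ℕP.m≤m+n a' k) (ℕP.n≤1+n _))) | ∉K-from-a (suc (a' + k)) (s≤s (ℕP.m≤m+n a' k))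
          | ∧-zeroʳ (a' <ᵇ suc (suc (a' + k))) = refl

    delete-at-top : ∀ z → z ∈ᵇ deleteAt Ka a ≡ z ∈ᵇ K
    delete-at-top z with dichotomy z a'
    ... | inj₁ z≤a' rewrite ∈-deleteAt Ka a' z | <ᵇ-true z a (s≤s z≤a') | <ᵇ-false a' z z≤a'
          | ∈-snoc-other z K a (ℕP.<⇒≢ (s≤s z≤a')) = ∨-identityʳ _
    ... | inj₂ (k , refl) rewrite ∈-deleteAt Ka a' (suc (a' + k)) | <ᵇ-false (suc (a' + k)) a (s≤s (ℕP.m≤m+n a' k))
          | <ᵇ-true a' (suc (a' + k)) (s≤s (ℕP.m≤m+n a' k))
          | ∈-snoc-other (suc (suc (a' + k))) K a (ℕP.>⇒≢ (s≤s (s≤s (ℕP.m≤m+n a' k))))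
          | ∉K-from-a (suc (suc (a' + k))) (s≤s (ℕP.≤-trans (ℕP.m≤m+n a' k) (ℕP.n≤1+n _)))
          | ∉K-from-a (suc (a' + k)) (s≤s (ℕP.m≤m+n a' k)) = refl

    boundary-below-top : ∀ p → p < a' → boundary Ka p ≡ boundary K p
    boundary-below-top p p<a' rewrite ∈-snoc-other (suc p) K a (ℕP.<⇒≢ (s≤s p<a')) | ∈-snoc-other p K a (ℕP.<⇒≢ (ℕP.m<n⇒m<1+n p<a')) = refl

    boundary-at-top : boundary Ka a' ≡ 𝟙 (not (a' ∈ᵇ K))
    boundary-at-top rewrite ∈-snoc-self K a | ∈-snoc-other a' K a (ℕP.<⇒≢ (ℕP.n<1+n a')) = refl

    boundary-above-top : ∀ p → a' < p → boundary Ka p ≡ 0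
    boundary-above-top p a'<p rewrite ∈-snoc-other (suc p) K a (ℕP.>⇒≢ (s≤s a'<p)) | ∉K-from-a (suc p) (s≤s (ℕP.<⇒≤ a'<p)) = refl

    boundary-from-top : ∀ p → a' ≤ p → boundary K p ≡ 0
    boundary-from-top p a'≤p rewrite ∉K-from-a (suc p) (s≤s a'≤p) = refl

    top-term : ∀ n → recTerm Ka a' (λ X → dcount X n) ≡ 𝟙 (not (a' ∈ᵇ K)) * shuffleCount K a' n
    top-term n = trans (cong₂ (λ b t → b * (t + dcount (deleteAt Ka a) n)) boundary-at-top shifted)
                       (cong (λ t → 𝟙 (not (a' ∈ᵇ K)) * (nonzero a' * dcount (K ++ [ a' ]) n + t)) (dcount-resp (deleteAt Ka a) K delete-at-top n))
      where
      shifted : 𝟙 (not (a' ≡ᵇ 0)) * dcount (shiftAt Ka a) n ≡ 𝟙 (not (a' ≡ᵇ 0)) * dcount (K ++ [ a' ]) n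
      shifted with a' ≡ᵇ 0 in a'≟0
      ... | true = refl
      ... | false = cong (1 *_) (dcount-resp (shiftAt Ka a) (K ++ [ a' ]) (shift-at-top (ℕP.n≢0⇒n>0 (λ a'≡0 → true≢false (trans (sym (cong (_≡ᵇ 0) a'≡0)) a'≟0)))) n)

    nonzero-a' : 0 < a' → nonzero a' ≡ 1
    nonzero-a' 0<a' rewrite ≡ᵇ-false {a'} {0} (ℕP.>⇒≢ 0<a') = refl

    appended-term : ∀ n p → recTerm Ka p (λ X → dcount X n)
                  ≡ nonzero a' * recTerm K p (λ X → dcount (X ++ [ a' ]) n) + 𝟙 (p ≡ᵇ a') * (𝟙 (not (a' ∈ᵇ K)) * shuffleCount K a' n)
    appended-term n p with trichotomy p a'
    ... | inj₁ p<a' = begin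
      recTerm Ka p (λ X → dcount X n)
        ≡⟨ cong₂ (λ b u → b * u) (boundary-below-top p p<a')
             (cong₂ (λ u v → nonzero p * u + v) (dcount-resp (shiftAt Ka (suc p)) (shiftAt K (suc p) ++ [ a' ]) (shift-below-top p p<a') n)
                                                       (dcount-resp (deleteAt Ka (suc p)) (deleteAt K (suc p) ++ [ a' ]) (delete-below-top p p<a') n)) ⟩
      R
        ≡⟨ sym (trans (ℕP.+-identityʳ _) (ℕP.+-identityʳ _)) ⟩
      1 * R + 0 * Y
        ≡⟨ sym (cong₂ (λ c d → c * R + d * Y) (nonzero-a' (ℕP.≤-<-trans z≤n p<a')) (cong 𝟙 (≡ᵇ-false (ℕP.<⇒≢ p<a')))) ⟩
      nonzero a' * R + 𝟙 (p ≡ᵇ a') * Y ∎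
      where
      R Y : ℕ
      R = recTerm K p (λ X → dcount (X ++ [ a' ]) n)
      Y = 𝟙 (not (a' ∈ᵇ K)) * shuffleCount K a' n
    ... | inj₂ (inj₁ refl) = begin
      recTerm Ka a' (λ X → dcount X n)    ≡⟨ top-term n ⟩
      Y                                  ≡⟨ sym (trans (cong (_+ 1 * Y) (ℕP.*-zeroʳ (nonzero a'))) (ℕP.+-identityʳ Y)) ⟩
      nonzero a' * 0 + 1 * Y             ≡⟨ sym (cong₂ (λ r b → nonzero a' * r + 𝟙 b * Y) (recTerm-off K a' (λ X → dcount (X ++ [ a' ]) n) (boundary-from-top a' ℕP.≤-refl)) (≡ᵇ-refl a')) ⟩
      nonzero a' * R + 𝟙 (a' ≡ᵇ a') * Y ∎
      where
      R Y : ℕ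
      R = recTerm K a' (λ X → dcount (X ++ [ a' ]) n)
      Y = 𝟙 (not (a' ∈ᵇ K)) * shuffleCount K a' n
    ... | inj₂ (inj₂ (k , refl)) = begin
      recTerm Ka p (λ X → dcount X n)    ≡⟨ recTerm-off Ka p (λ X → dcount X n) (boundary-above-top p a'<p) ⟩
      0                                  ≡⟨ sym (trans (ℕP.+-identityʳ _) (ℕP.*-zeroʳ (nonzero a'))) ⟩
      nonzero a' * 0 + 0 * Y             ≡⟨ sym (cong₂ (λ r d → nonzero a' * r + d * Y) (recTerm-off K p (λ X → dcount (X ++ [ a' ]) n) (boundary-from-top p (ℕP.<⇒≤ a'<p))) (cong 𝟙 (≡ᵇ-false (ℕP.>⇒≢ a'<p)))) ⟩
      nonzero a' * recTerm K p (λ X → dcount (X ++ [ a' ]) n) + 𝟙 (p ≡ᵇ a') * Y ∎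
      where
      a'<p : a' < p
      a'<p = s≤s (ℕP.m≤m+n a' k)
      Y : ℕ
      Y = 𝟙 (not (a' ∈ᵇ K)) * shuffleCount K a' n

    shuffle-step : ∀ n → a' < n → shuffleCount K a (suc n)
                 ≡ shuffleCount K a n + (∑ (upTo n) (λ p → recTerm K p (λ X → shuffleCount X a' n)) + 𝟙 (not (a' ∈ᵇ K)) * shuffleCount K a' n)
    shuffle-step n a'<n = begin
      1 * dcount Ka (suc n) + dcount K (suc n)
        ≡⟨ cong₂ (λ x y → 1 * x + y) (descent-recurrence Ka n) (descent-recurrence K n) ⟩
      1 * (∑ (upTo n) (λ p → recTerm Ka p (λ X → dcount X n)) + dcount Ka n) + (∑K + dcount K n)
        ≡⟨ cong (λ t → 1 * (t + dcount Ka n) + (∑K + dcount K n)) appended-sum ⟩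
      1 * ((nonzero a' * ∑G + Y) + dcount Ka n) + (∑K + dcount K n)
        ≡⟨ solve 6 (λ z G Y A B C → con 1 :* ((z :* G :+ Y) :+ A) :+ (B :+ C) := (con 1 :* A :+ C) :+ ((z :* G :+ B) :+ Y)) refl
             (nonzero a') ∑G Y (dcount Ka n) ∑K (dcount K n) ⟩
      shuffleCount K a n + ((nonzero a' * ∑G + ∑K) + Y)
        ≡⟨ cong (λ t → shuffleCount K a n + (t + Y)) (sym summands) ⟩
      shuffleCount K a n + (∑ (upTo n) (λ p → recTerm K p (λ X → shuffleCount X a' n)) + Y) ∎
      where
      ∑G ∑K Y : ℕ
      ∑G = ∑ (upTo n) (λ p → recTerm K p (λ X → dcount (X ++ [ a' ]) n))
      ∑K = ∑ (upTo n) (λ p → recTerm K p (λ X → dcount X n))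
      Y = 𝟙 (not (a' ∈ᵇ K)) * shuffleCount K a' n
      appended-sum : ∑ (upTo n) (λ p → recTerm Ka p (λ X → dcount X n)) ≡ nonzero a' * ∑G + Y
      appended-sum = trans (∑-cong (upTo n) (appended-term n))
        (trans (∑-+ (upTo n) _ _) (cong₂ _+_ (∑-scalar (upTo n) (nonzero a') _) (∑-delta n a' (λ _ → Y) a'<n)))
      summands : ∑ (upTo n) (λ p → recTerm K p (λ X → shuffleCount X a' n)) ≡ nonzero a' * ∑G + ∑K
      summands = trans (∑-cong (upTo n) (λ p → trans (recTerm-+ K p (λ X → nonzero a' * dcount (X ++ [ a' ]) n) (λ X → dcount X n))
                                                      (cong (_+ recTerm K p (λ X → dcount X n)) (recTerm-scalar K p (nonzero a') (λ X → dcount (X ++ [ a' ]) n)))))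
        (trans (∑-+ (upTo n) _ _) (cong (_+ ∑K) (∑-scalar (upTo n) (nonzero a') _)))

  -- If the shuffle identity holds at level a' (for length n), the increment
  -- in shuffle-step is C(n, a') · d(K, a'+1): every shuffle count becomes
  -- C(n, a') times a count at length a', and these recombine by the descent
  -- recurrence at length a'.
  shuffle-increment : ∀ K a' n → 0 ∈ᵇ K ≡ false → (∀ z → z ∈ᵇ K ≡ true → z < suc a') → a' ≤ n →
    (∀ X → 0 ∈ᵇ X ≡ false → (∀ z → z ∈ᵇ X ≡ true → z < a') → shuffleCount X a' n ≡ dcount X a' * (n C a')) →
    ∑ (upTo n) (λ p → recTerm K p (λ X → shuffleCount X a' n)) + 𝟙 (not (a' ∈ᵇ K)) * shuffleCount K a' n ≡ (n C a') * dcount K (suc a')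
  shuffle-increment K a' n 0∉K K<a a'≤n level-a' = begin
    ∑ (upTo n) (λ p → recTerm K p (λ X → shuffleCount X a' n)) + 𝟙 (not (a' ∈ᵇ K)) * shuffleCount K a' n
      ≡⟨ cong₂ _+_ (trans (∑-cong (upTo n) summand) (∑-scalar (upTo n) c _)) top ⟩
    c * ∑ (upTo n) (λ p → recTerm K p (λ X → dcount X a')) + c * dcount K a'
      ≡⟨ cong (λ t → c * t + c * dcount K a') truncate ⟩
    c * ∑ (upTo a') (λ p → recTerm K p (λ X → dcount X a')) + c * dcount K a'
      ≡⟨ sym (ℕP.*-distribˡ-+ c _ _) ⟩
    c * (∑ (upTo a') (λ p → recTerm K p (λ X → dcount X a')) + dcount K a')
      ≡⟨ cong (c *_) (sym (descent-recurrence K a')) ⟩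
    c * dcount K (suc a') ∎
    where
    open AppendTop K a' K<a
    c : ℕ
    c = n C a'
    summand : ∀ p → recTerm K p (λ X → shuffleCount X a' n) ≡ c * recTerm K p (λ X → dcount X a')
    summand p = trans (recTerm-cong K p {λ X → shuffleCount X a' n} {λ X → c * dcount X a'} (λ p+1∈K →
        trans (level-a' (shiftAt K (suc p)) (shiftAt-positive K p 0∉K) (shiftAt-below-bound K p a' K<a p+1∈K)) (ℕP.*-comm _ c) ,
        trans (level-a' (deleteAt K (suc p)) (deleteAt-positive K p 0∉K) (deleteAt-below-bound K p a' K<a p+1∈K)) (ℕP.*-comm _ c)))
      (recTerm-scalar K p c (λ X → dcount X a'))
    top : 𝟙 (not (a' ∈ᵇ K)) * shuffleCount K a' n ≡ c * dcount K a'
    top with a' ∈ᵇ K in a'∈K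
    ... | true = sym (trans (cong (c *_) (dcount-too-short K a' a' a'∈K ℕP.≤-refl)) (ℕP.*-zeroʳ c))
    ... | false = trans (ℕP.+-identityʳ _) (trans (level-a' K 0∉K (bound-tighten K a' K<a a'∈K)) (ℕP.*-comm _ c))
    truncate : ∑ (upTo n) (λ p → recTerm K p (λ X → dcount X a')) ≡ ∑ (upTo a') (λ p → recTerm K p (λ X → dcount X a'))
    truncate = trans (cong (λ t → ∑ (upTo t) _) (sym (ℕP.m+[n∸m]≡n a'≤n)))
      (∑-upTo-trunc a' (n ℕ.∸ a') _ (λ p a'≤p → recTerm-off K p (λ X → dcount X a') (boundary-from-top p a'≤p)))

  shuffle-identity : ∀ a K → 0 ∈ᵇ K ≡ false → (∀ z → z ∈ᵇ K ≡ true → z < a) → ∀ j →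
                     shuffleCount K a (a + j) ≡ dcount K a * ((a + j) C a)
  shuffle-identity zero K 0∉K K<0 j =
    trans (dcount-no-descents K none j) (sym (trans (ℕP.*-identityʳ _) (dcount-no-descents K none 0)))
    where
    none : ∀ z → z ∈ᵇ K ≡ false
    none z = not-true (λ z∈K → ℕP.n≮0 (K<0 z z∈K))
  shuffle-identity (suc a') K 0∉K K<a zero = begin
    1 * dcount (K ++ [ suc a' ]) (suc a' + 0) + dcount K (suc a' + 0)
      ≡⟨ cong (λ t → 1 * dcount (K ++ [ suc a' ]) t + dcount K t) (ℕP.+-identityʳ (suc a')) ⟩
    1 * dcount (K ++ [ suc a' ]) (suc a') + dcount K (suc a')
      ≡⟨ cong (λ t → 1 * t + dcount K (suc a')) (dcount-too-short (K ++ [ suc a' ]) (suc a') (suc a') (∈-snoc-self K (suc a')) ℕP.≤-refl) ⟩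
    dcount K (suc a')
      ≡⟨ sym (trans (cong (dcount K (suc a') *_) (trans (cong (_C suc a') (ℕP.+-identityʳ (suc a'))) (nCn≡1 (suc a')))) (ℕP.*-identityʳ _)) ⟩
    dcount K (suc a') * ((suc a' + 0) C suc a') ∎
  shuffle-identity (suc a') K 0∉K K<a (suc j) = begin
    shuffleCount K a (a + suc j)
      ≡⟨ cong (shuffleCount K a) (ℕP.+-suc a j) ⟩
    shuffleCount K a (suc n)
      ≡⟨ AppendTop.shuffle-step K a' K<a n (s≤s (ℕP.m≤m+n a' j)) ⟩
    shuffleCount K a n + (∑ (upTo n) (λ p → recTerm K p (λ X → shuffleCount X a' n)) + 𝟙 (not (a' ∈ᵇ K)) * shuffleCount K a' n)
      ≡⟨ cong₂ _+_ (shuffle-identity (suc a') K 0∉K K<a j) (shuffle-increment K a' n 0∉K K<a (ℕP.≤-trans (ℕP.n≤1+n a') (ℕP.m≤m+n a j)) level-a') ⟩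
    dcount K a * (n C a) + (n C a') * dcount K a
      ≡⟨ solve 3 (λ d x y → d :* x :+ y :* d := d :* (y :+ x)) refl (dcount K a) (n C a) (n C a') ⟩
    dcount K a * ((n C a') + (n C a))
      ≡⟨ cong (dcount K a *_) (nCk+nC[k+1]≡[n+1]C[k+1] n a') ⟩
    dcount K a * (suc n C a)
      ≡⟨ cong (λ t → dcount K a * (t C a)) (sym (ℕP.+-suc a j)) ⟩
    dcount K a * ((a + suc j) C a) ∎
    where
    a n : ℕ
    a = suc a'
    n = a + j
    level-a' : ∀ X → 0 ∈ᵇ X ≡ false → (∀ z → z ∈ᵇ X ≡ true → z < a') → shuffleCount X a' n ≡ dcount X a' * (n C a')
    level-a' X 0∉X X<a' = begin
      shuffleCount X a' n                  ≡⟨ cong (shuffleCount X a') n≡a'+[j+1] ⟩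
      shuffleCount X a' (a' + suc j)       ≡⟨ shuffle-identity a' X 0∉X X<a' (suc j) ⟩
      dcount X a' * ((a' + suc j) C a')    ≡⟨ cong (λ t → dcount X a' * (t C a')) (sym n≡a'+[j+1]) ⟩
      dcount X a' * (n C a')               ∎
      where
      n≡a'+[j+1] : n ≡ a' + suc j
      n≡a'+[j+1] = sym (ℕP.+-suc a' j)

  shuffle-identity-≥ : ∀ a K n → 0 ∈ᵇ K ≡ false → (∀ z → z ∈ᵇ K ≡ true → z < a) → a ≤ n →
                       shuffleCount K a n ≡ dcount K a * (n C a)
  shuffle-identity-≥ a K n 0∉K K<a a≤n =
    subst (λ t → shuffleCount K a t ≡ dcount K a * (t C a)) (ℕP.m+[n∸m]≡n a≤n) (shuffle-identity a K 0∉K K<a (n ℕ.∸ a))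

-- Finite sets given as strictly increasing lists, and the passage between
-- the paper's index-based notation (I_t, Î_t for t-th element i_t) and the
-- value-based shiftAt/deleteAt.
module SortedLists where
  open import Defs
  open BoolSets
  open FiniteSums
  open DescentRecurrence using (shiftAt; deleteAt; ∈-shiftAt; ∈-deleteAt)
  open import Data.Nat as ℕ using (ℕ; zero; suc; pred; _+_; _*_; _<_; _≤_; z≤n; s≤s; _≡ᵇ_; _<ᵇ_; _≤ᵇ_; _∸_)
  import Data.Nat.Properties as ℕP
  open import Data.Bool using (true; false; not; _∧_; _∨_)
  open import Data.Bool.Properties using (∨-identityʳ; ∧-zeroʳ)
  open import Data.List using (List; []; _∷_; [_]; _++_; map; length; filterᵇ; upTo; take; drop; zip)
  import Data.List.Properties as LP
  open import Data.List.Relation.Unary.All using (All; []; _∷_)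
  import Data.List.Relation.Unary.All.Properties as AllP
  open import Data.List.Relation.Unary.Linked using (Linked; []; [-]; _∷_)
  open import Data.Product using (_,_; proj₁; proj₂; _×_)
  open import Data.Sum using (inj₁; inj₂)
  open import Data.Empty using (⊥-elim)
  open import Relation.Binary.Definitions using (tri<; tri≈; tri>)
  open import Relation.Binary.PropositionalEquality hiding ([_])
  open ≡-Reasoning

  linked-head< : ∀ {y L} → Linked _<_ (y ∷ L) → ∀ z → z ∈ᵇ L ≡ true → y < z
  linked-head< {y} {w ∷ L} (yw ∷ lk) z m with ∈-cons-true z w L m
  ... | inj₁ refl = yw
  ... | inj₂ m' = ℕP.<-trans yw (linked-head< lk z m')

  linked-tail : ∀ {y L} → Linked _<_ (y ∷ L) → Linked _<_ L
  linked-tail [-] = []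
  linked-tail (_ ∷ lk) = lk

  linked-drop : ∀ A {L} → Linked _<_ (A ++ L) → Linked _<_ L
  linked-drop [] lk = lk
  linked-drop (a ∷ A) lk = linked-drop A (linked-tail lk)

  linked-prefix< : ∀ A {x R} → Linked _<_ (A ++ x ∷ R) → ∀ z → z ∈ᵇ A ≡ true → z < x
  linked-prefix< (a ∷ A) {x} {R} lk z m with ∈-cons-true z a A m
  ... | inj₁ refl = linked-head< lk x (∈-here x A R)
  ... | inj₂ m' = linked-prefix< A (linked-tail lk) z m'

  module AtIndex (I : List ℕ) (sorted : Linked _<_ I) (0∉I : 0 ∈ᵇ I ≡ false) (s x : ℕ) (at-s : drop s I ≡ x ∷ drop (suc s) I) where
    A R : List ℕ
    A = take s I
    R = drop (suc s) I

    split-eq : A ++ x ∷ R ≡ I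
    split-eq = trans (cong (take s I ++_) (sym at-s)) (LP.take++drop≡id s I)

    ∈-split : ∀ z → z ∈ᵇ I ≡ ((z ∈ᵇ A) ∨ ((z ≡ᵇ x) ∨ (z ∈ᵇ R)))
    ∈-split z = trans (cong (z ∈ᵇ_) (sym split-eq)) (∈ᵇ-++ z A (x ∷ R))

    split-sorted : Linked _<_ (A ++ x ∷ R)
    split-sorted = subst (Linked _<_) (sym split-eq) sorted

    ∉prefix : ∀ z → x ≤ z → z ∈ᵇ A ≡ false
    ∉prefix z x≤z = not-true (λ z∈A → ℕP.<-irrefl refl (ℕP.<-≤-trans (linked-prefix< A split-sorted z z∈A) x≤z))

    ∉suffix : ∀ z → z ≤ x → z ∈ᵇ R ≡ false
    ∉suffix z z≤x = not-true (λ z∈R → ℕP.<-irrefl refl (ℕP.<-≤-trans (linked-head< (linked-drop A split-sorted) z z∈R) z≤x))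

    ∈-prefix : ∀ z → z ∈ᵇ A ≡ ((z <ᵇ x) ∧ (z ∈ᵇ I))
    ∈-prefix z rewrite ∈-split z with trichotomy z x
    ... | inj₁ lt rewrite <ᵇ-true z x lt | ≡ᵇ-false (ℕP.<⇒≢ lt) | ∉suffix z (ℕP.<⇒≤ lt) = sym (∨-identityʳ _)
    ... | inj₂ (inj₁ refl) rewrite ∉prefix z ℕP.≤-refl | <ᵇ-false z z ℕP.≤-refl = refl
    ... | inj₂ (inj₂ (k , refl)) rewrite ∉prefix (suc (x + k)) (ℕP.≤-trans (ℕP.m≤m+n x k) (ℕP.n≤1+n _)) | <ᵇ-false (suc (x + k)) x (ℕP.≤-trans (ℕP.m≤m+n x k) (ℕP.n≤1+n _)) = refl

    ∈-suffix : ∀ z → z ∈ᵇ R ≡ ((x <ᵇ z) ∧ (z ∈ᵇ I))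
    ∈-suffix z rewrite ∈-split z with trichotomy z x
    ... | inj₁ lt rewrite ∉suffix z (ℕP.<⇒≤ lt) | <ᵇ-false x z (ℕP.<⇒≤ lt) = refl
    ... | inj₂ (inj₁ refl) rewrite ∉suffix z ℕP.≤-refl | <ᵇ-false z z ℕP.≤-refl = refl
    ... | inj₂ (inj₂ (k , refl)) rewrite ∉prefix (suc (x + k)) (ℕP.≤-trans (ℕP.m≤m+n x k) (ℕP.n≤1+n _)) | <ᵇ-true x (suc (x + k)) (s≤s (ℕP.m≤m+n x k)) | ≡ᵇ-false (ℕP.>⇒≢ (s≤s (ℕP.m≤m+n x k))) = refl

    ∈-from : ∀ z → z ∈ᵇ (x ∷ R) ≡ ((x ≤ᵇ z) ∧ (z ∈ᵇ I))
    ∈-from z rewrite ∈-split z with trichotomy z x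
    ... | inj₁ lt rewrite ≡ᵇ-false (ℕP.<⇒≢ lt) | ∉suffix z (ℕP.<⇒≤ lt) | ≤ᵇ-false lt = refl
    ... | inj₂ (inj₁ refl) rewrite ∉prefix z ℕP.≤-refl | ≡ᵇ-refl z | ≤ᵇ-true (ℕP.≤-refl {z}) = refl
    ... | inj₂ (inj₂ (k , refl)) rewrite ∉prefix (suc (x + k)) (ℕP.≤-trans (ℕP.m≤m+n x k) (ℕP.n≤1+n _)) | ≤ᵇ-true (ℕP.≤-trans (ℕP.m≤m+n x k) (ℕP.n≤1+n (x + k))) = refl

    x∈I : x ∈ᵇ I ≡ true
    x∈I = trans (cong (x ∈ᵇ_) (sym split-eq)) (∈-here x A R)

    p : ℕ
    p = pred x

    x≡suc-p : x ≡ suc p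
    x≡suc-p = sym (ℕP.suc-pred x {{ℕ.>-nonZero (ℕP.n≢0⇒n>0 x≢0)}})
      where
      x≢0 : x ≢ 0
      x≢0 x≡0 = true≢false (trans (sym (subst (λ y → y ∈ᵇ I ≡ true) x≡0 x∈I)) 0∉I)

    map-∸1 : ∀ L → map (λ x → x ∸ 1) L ≡ map pred L
    map-∸1 = LP.map-cong (λ { zero → refl ; (suc _) → refl })

    Ist≈shiftAt : ∀ z → z ∈ᵇ Ist I s ≡ z ∈ᵇ shiftAt I x
    Ist≈shiftAt z rewrite ∈ᵇ-++ z (take s I) (filterᵇ (λ x → not (x ≡ᵇ 0)) (map (λ x → x ∸ 1) (drop s I))) | at-s
      | ∈-filter (λ x → not (x ≡ᵇ 0)) (map (λ x → x ∸ 1) (x ∷ R)) z | map-∸1 (x ∷ R) | ∈-map-pred (x ∷ R) z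
      | ∧-not-absorbs (z ≡ᵇ 0) (suc z ∈ᵇ (x ∷ R)) (0 ∈ᵇ (x ∷ R)) | ∈-prefix z | ∈-from (suc z) | x≡suc-p | ∈-shiftAt I p z = refl

    Ihat≈deleteAt : ∀ z → z ∈ᵇ Ihat I s ≡ z ∈ᵇ deleteAt I x
    Ihat≈deleteAt z rewrite ∈ᵇ-++ z (take s I) (map (λ x → x ∸ 1) R) | map-∸1 R | ∈-map-pred R z | ∉suffix 0 z≤n
      | ∧-zeroʳ (z ≡ᵇ 0) | ∨-identityʳ (suc z ∈ᵇ R) | ∈-prefix z | ∈-suffix (suc z) | x≡suc-p | ∈-deleteAt I p z = refl

  shift : ℕ × ℕ → ℕ × ℕ
  shift e = suc (proj₁ e) , proj₂ e

  zip-map-suc : ∀ (A B : List ℕ) → zip (map suc A) B ≡ map shift (zip A B)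
  zip-map-suc [] B = refl
  zip-map-suc (a ∷ A) [] = refl
  zip-map-suc (a ∷ A) (b ∷ B) = cong ((suc a , b) ∷_) (zip-map-suc A B)

  enum-cons : ∀ y I → enum (y ∷ I) ≡ (0 , y) ∷ map shift (enum I)
  enum-cons y I = cong ((0 , y) ∷_) (trans (cong (λ L → zip L I) (sym (LP.map-upTo suc (length I)))) (zip-map-suc (upTo (length I)) I))

  IsIndexOf : List ℕ → ℕ × ℕ → Set
  IsIndexOf I e = drop (proj₁ e) I ≡ proj₂ e ∷ drop (suc (proj₁ e)) I

  enum-indices : ∀ I → All (IsIndexOf I) (enum I)
  enum-indices [] = []
  enum-indices (y ∷ I) = subst (All (IsIndexOf (y ∷ I))) (sym (enum-cons y I)) (refl ∷ AllP.map⁺ (enum-indices I))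

  proj₂-enum : ∀ I → map proj₂ (enum I) ≡ I
  proj₂-enum [] = refl
  proj₂-enum (y ∷ I) = trans (cong (map proj₂) (enum-cons y I)) (cong (y ∷_) (trans (sym (LP.map-∘ {g = proj₂} {f = shift} (enum I))) (proj₂-enum I)))

  map-∸1 : ∀ L → map (λ x → x ∸ 1) L ≡ map pred L
  map-∸1 = LP.map-cong (λ { zero → refl ; (suc _) → refl })

  ∑-cong-∈ : ∀ L {f g : ℕ → ℕ} → (∀ x → x ∈ᵇ L ≡ true → f x ≡ g x) → ∑ L f ≡ ∑ L g
  ∑-cong-∈ [] agree = refl
  ∑-cong-∈ (y ∷ L) agree = cong₂ _+_ (agree y (∈-here y [] L)) (∑-cong-∈ L (λ x x∈L → agree x (∈-there x y L x∈L)))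

  ∑-delta-∈ : ∀ L m (G : ℕ → ℕ) → Linked _<_ L → m ∈ᵇ L ≡ true → ∑ L (λ x → 𝟙 (x ≡ᵇ m) * G x) ≡ G m
  ∑-delta-∈ (w ∷ L) m G sorted m∈ with ∈-cons-true m w L m∈
  ... | inj₁ refl rewrite ≡ᵇ-refl m = begin
    (G m + 0) + ∑ L (λ x → 𝟙 (x ≡ᵇ m) * G x)  ≡⟨ cong₂ _+_ (ℕP.+-identityʳ (G m)) (trans (∑-cong-∈ L off) (∑-zero L (λ _ → refl))) ⟩
    G m + 0                                   ≡⟨ ℕP.+-identityʳ (G m) ⟩
    G m                                       ∎
    where
    off : ∀ x → x ∈ᵇ L ≡ true → 𝟙 (x ≡ᵇ m) * G x ≡ 0
    off x x∈L = cong (λ b → 𝟙 b * G x) (≡ᵇ-false (ℕP.>⇒≢ (linked-head< sorted x x∈L)))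
  ... | inj₂ m∈L rewrite ≡ᵇ-false (ℕP.<⇒≢ (linked-head< sorted m m∈L)) = ∑-delta-∈ L m G (linked-tail sorted) m∈L

  ∑-positions : ∀ n L → Linked _<_ L → 0 ∈ᵇ L ≡ false → (∀ z → z ∈ᵇ L ≡ true → z ≤ n) → ∀ (F : ℕ → ℕ) →
                ∑ (upTo n) (λ p → 𝟙 (suc p ∈ᵇ L) * F (suc p)) ≡ ∑ L F
  ∑-positions n [] sorted 0∉L L≤n F = ∑-zero (upTo n) (λ _ → refl)
  ∑-positions n (zero ∷ L) sorted 0∉L L≤n F = ⊥-elim (true≢false 0∉L)
  ∑-positions n (suc y ∷ L) sorted 0∉L L≤n F = begin
    ∑ (upTo n) (λ p → 𝟙 (suc p ∈ᵇ (suc y ∷ L)) * F (suc p))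
      ≡⟨ ∑-cong (upTo n) split ⟩
    ∑ (upTo n) (λ p → 𝟙 (p ≡ᵇ y) * F (suc p) + 𝟙 (suc p ∈ᵇ L) * F (suc p))
      ≡⟨ ∑-+ (upTo n) _ _ ⟩
    ∑ (upTo n) (λ p → 𝟙 (p ≡ᵇ y) * F (suc p)) + ∑ (upTo n) (λ p → 𝟙 (suc p ∈ᵇ L) * F (suc p))
      ≡⟨ cong₂ _+_ (∑-delta n y (λ p → F (suc p)) (L≤n (suc y) (∈-here (suc y) [] L)))
                   (∑-positions n L (linked-tail sorted) 0∉tail (λ z z∈L → L≤n z (∈-there z (suc y) L z∈L)) F) ⟩
    F (suc y) + ∑ L F ∎
    where
    0∉tail : 0 ∈ᵇ L ≡ false
    0∉tail = not-true (λ 0∈L → true≢false (trans (sym (∈-there 0 (suc y) L 0∈L)) 0∉L))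
    split : ∀ p → 𝟙 (suc p ∈ᵇ (suc y ∷ L)) * F (suc p) ≡ 𝟙 (p ≡ᵇ y) * F (suc p) + 𝟙 (suc p ∈ᵇ L) * F (suc p)
    split p with p ≡ᵇ y in p≟y
    ... | true rewrite ≡ᵇ-true p y p≟y | not-true {suc y ∈ᵇ L} (λ y+1∈L → ℕP.<-irrefl refl (linked-head< sorted (suc y) y+1∈L)) = sym (ℕP.+-identityʳ _)
    ... | false = refl

  lastOf : ℕ → List ℕ → ℕ
  lastOf y [] = y
  lastOf y (w ∷ L) = lastOf w L

  init-last : ∀ y L → y ∷ L ≡ initL (y ∷ L) ++ [ lastOf y L ]
  init-last y [] = refl
  init-last y (w ∷ L) = cong (y ∷_) (init-last w L)

  mx≡last : ∀ y L → Linked _<_ (y ∷ L) → mx (y ∷ L) ≡ lastOf y L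
  mx≡last y L sorted = ℕP.≤-antisym (mx-lub (y ∷ L) (lastOf y L) ≤last) (mx-ub (y ∷ L) (lastOf y L) last∈)
    where
    K : List ℕ
    K = initL (y ∷ L)
    split-sorted : Linked _<_ (K ++ lastOf y L ∷ [])
    split-sorted = subst (Linked _<_) (init-last y L) sorted
    last∈ : lastOf y L ∈ᵇ (y ∷ L) ≡ true
    last∈ = subst (λ X → lastOf y L ∈ᵇ X ≡ true) (sym (init-last y L)) (∈-snoc-self K (lastOf y L))
    ≤last : ∀ z → z ∈ᵇ (y ∷ L) ≡ true → z ≤ lastOf y L
    ≤last z z∈ with ℕP.<-cmp z (lastOf y L)
    ... | tri< z<last _ _ = ℕP.<⇒≤ z<last
    ... | tri≈ _ refl _ = ℕP.≤-refl
    ... | tri> _ _ last<z = ⊥-elim (true≢false (trans (sym (subst (λ X → z ∈ᵇ X ≡ true) (init-last y L) z∈))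
            (trans (∈-snoc-other z K (lastOf y L) (ℕP.>⇒≢ last<z)) (not-true (λ z∈K → ℕP.<-asym last<z (linked-prefix< K split-sorted z z∈K))))))

module Binomials where
  open import Defs
  open NatCast
  open Polynomials
  open import Data.Nat as ℕ using (zero; suc)
  import Data.Nat.Properties as ℕP
  open import Data.Nat.Combinatorics using (_C_; nCk+nC[k+1]≡[n+1]C[k+1])
  open import Data.Integer using (+_)
  open import Data.Rational using (ℚ; _/_; _+_; _-_; _*_; 0ℚ; 1ℚ)
  open import Data.Rational.Properties using (*-zeroˡ)
  open import Data.Rational.Solver using (module +-*-Solver)
  open +-*-Solver
  open import Relation.Binary.PropositionalEquality
  open ≡-Reasoning

  poly-binom : ∀ k → IsPoly (λ x → binom x k)
  poly-binom zero = poly-const 1ℚ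
  poly-binom (suc k) = poly-* (poly-binom k) (poly-* (poly-- poly-id (poly-const (ℕtoℚ k))) (poly-const (+ 1 / suc k)))

  -- 1/(k+2) + 1/(k+2)·1/(k+1) = 1/(k+1), from (k+2)·1/(k+2) = 1 = (k+1)·1/(k+1).
  reciprocal-step : ∀ k → (+ 1 / suc (suc k)) + (+ 1 / suc (suc k)) * (+ 1 / suc k) - (+ 1 / suc k) ≡ 0ℚ
  reciprocal-step k = begin
    u + u * v - v                             ≡⟨ solve 2 (λ u v → u :+ u :* v :- v := u :+ u :* v :- v :* con 1ℚ) refl u v ⟩
    u + u * v - v * 1ℚ                        ≡⟨ cong (λ t → u + u * v - v * t) (sym (ℕtoℚ-suc*inverse (suc k))) ⟩
    u + u * v - v * (ℕtoℚ (suc (suc k)) * u)  ≡⟨ cong (λ t → u + u * v - v * (t * u)) (ℕtoℚ-suc (suc k)) ⟩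
    u + u * v - v * ((k+1 + 1ℚ) * u)          ≡⟨ solve 3 (λ u v k+1 → u :+ u :* v :- v :* ((k+1 :+ con 1ℚ) :* u) := u :- u :* (k+1 :* v)) refl u v k+1 ⟩
    u - u * (k+1 * v)                         ≡⟨ cong (λ t → u - u * t) (ℕtoℚ-suc*inverse k) ⟩
    u - u * 1ℚ                                ≡⟨ solve 1 (λ u → u :- u :* con 1ℚ := con 0ℚ) refl u ⟩
    0ℚ                                        ∎
    where
    u v k+1 : ℚ
    u = + 1 / suc (suc k)
    v = + 1 / suc k
    k+1 = ℕtoℚ (suc k)

  binom-pascal : ∀ k x → binom (x + 1ℚ) (suc k) ≡ binom x (suc k) + binom x k
  binom-pascal zero x = solve 1 (λ x → con 1ℚ :* ((x :+ con 1ℚ :- con 0ℚ) :* con 1ℚ) := con 1ℚ :* ((x :- con 0ℚ) :* con 1ℚ) :+ con 1ℚ) refl x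
  binom-pascal (suc k) x = begin
    binom (x + 1ℚ) (suc k) * ((x + 1ℚ - K1) * u)
      ≡⟨ cong (λ t → t * ((x + 1ℚ - K1) * u)) (binom-pascal k x) ⟩
    (B * ((x - K0) * v) + B) * ((x + 1ℚ - K1) * u)
      ≡⟨ cong (λ t → (B * ((x - K0) * v) + B) * ((x + 1ℚ - t) * u)) (ℕtoℚ-suc k) ⟩
    (B * ((x - K0) * v) + B) * ((x + 1ℚ - (K0 + 1ℚ)) * u)
      ≡⟨ solve 5 (λ B x K0 u v → (B :* ((x :- K0) :* v) :+ B) :* ((x :+ con 1ℚ :- (K0 :+ con 1ℚ)) :* u) :=
                                 B :* ((x :- K0) :* v) :* ((x :- K0 :- con 1ℚ) :* u) :+ B :* ((x :- K0) :* v) :+ B :* (x :- K0) :* (u :+ u :* v :- v)) refl B x K0 u v ⟩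
    B * ((x - K0) * v) * ((x - K0 - 1ℚ) * u) + B * ((x - K0) * v) + B * (x - K0) * (u + u * v - v)
      ≡⟨ cong (λ t → B * ((x - K0) * v) * ((x - K0 - 1ℚ) * u) + B * ((x - K0) * v) + B * (x - K0) * t) (reciprocal-step k) ⟩
    B * ((x - K0) * v) * ((x - K0 - 1ℚ) * u) + B * ((x - K0) * v) + B * (x - K0) * 0ℚ
      ≡⟨ solve 5 (λ B x K0 u v → B :* ((x :- K0) :* v) :* ((x :- K0 :- con 1ℚ) :* u) :+ B :* ((x :- K0) :* v) :+ B :* (x :- K0) :* con 0ℚ :=
                                 B :* ((x :- K0) :* v) :* ((x :- (K0 :+ con 1ℚ)) :* u) :+ B :* ((x :- K0) :* v)) refl B x K0 u v ⟩
    B * ((x - K0) * v) * ((x - (K0 + 1ℚ)) * u) + B * ((x - K0) * v)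
      ≡⟨ cong (λ t → B * ((x - K0) * v) * ((x - t) * u) + B * ((x - K0) * v)) (sym (ℕtoℚ-suc k)) ⟩
    binom x (suc (suc k)) + binom x (suc k) ∎
    where
    B K0 K1 u v : ℚ
    B = binom x k
    K0 = ℕtoℚ k
    K1 = ℕtoℚ (suc k)
    u = + 1 / suc (suc k)
    v = + 1 / suc k

  binom-0 : ∀ k → binom 0ℚ (suc k) ≡ 0ℚ
  binom-0 zero = refl
  binom-0 (suc k) = trans (cong (λ t → t * ((0ℚ - ℕtoℚ (suc k)) * (+ 1 / suc (suc k)))) (binom-0 k)) (*-zeroˡ ((0ℚ - ℕtoℚ (suc k)) * (+ 1 / suc (suc k))))

  -- At naturals, binom agrees with the binomial coefficient (Pascal's rule on both sides).
  binom-nat : ∀ n k → binom (ℕtoℚ n) k ≡ ℕtoℚ (n C k)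
  binom-nat n zero = refl
  binom-nat zero (suc k) = binom-0 k
  binom-nat (suc n) (suc k) = begin
    binom (ℕtoℚ (suc n)) (suc k)              ≡⟨ cong (λ t → binom t (suc k)) (ℕtoℚ-suc n) ⟩
    binom (ℕtoℚ n + 1ℚ) (suc k)               ≡⟨ binom-pascal k (ℕtoℚ n) ⟩
    binom (ℕtoℚ n) (suc k) + binom (ℕtoℚ n) k ≡⟨ cong₂ _+_ (binom-nat n (suc k)) (binom-nat n k) ⟩
    ℕtoℚ (n C suc k) + ℕtoℚ (n C k)           ≡⟨ sym (ℕtoℚ-+ (n C suc k) (n C k)) ⟩
    ℕtoℚ (n C suc k ℕ.+ n C k)                ≡⟨ cong ℕtoℚ (trans (ℕP.+-comm (n C suc k) (n C k)) (nCk+nC[k+1]≡[n+1]C[k+1] n k)) ⟩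
    ℕtoℚ (suc n C suc k)                      ∎

module DescentPolynomials where
  open import Defs
  open NatCast
  open Polynomials
  open BoolSets
  open FiniteSums
  open DescentRecurrence
  open import Data.Nat as ℕ using (ℕ; zero; suc; _<_; _≤_; s≤s)
  import Data.Nat.Properties as ℕP
  open import Data.Bool using (true; false; not; _∧_)
  open import Data.List using (List; []; _∷_; map; upTo)
  open import Data.List.Relation.Unary.All using (All; []; _∷_)
  import Data.List.Relation.Unary.All.Properties as AllP
  open import Data.Product using (_×_; _,_; proj₁; proj₂)
  open import Data.Empty using (⊥-elim)
  open import Data.Rational using (ℚ; _+_; _-_; _*_; 0ℚ; 1ℚ)
  open import Data.Rational.Properties using (+-comm)
  open import Data.Rational.Solver using (module +-*-Solver)
  open +-*-Solver
  open import Relation.Binary.PropositionalEquality hiding (J)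
  open ≡-Reasoning

  Positive : List ℕ → Set
  Positive J = All (λ j → 0 < j) J

  module _ (D : List ℕ → ℚ → ℚ) (isD : IsDescentPoly D) where

    D-poly : ∀ J → Positive J → IsPoly (D J)
    D-poly J pos = proj₁ (isD J pos) , proj₁ (proj₂ (proj₂ (isD J pos)))

    D-count : ∀ J → Positive J → ∀ n → mx J < n → D J (ℕtoℚ n) ≡ ℕtoℚ (dcount J n)
    D-count J pos = proj₂ (proj₂ (proj₂ (isD J pos)))

    D-no-descents : ∀ K → Positive K → (∀ z → z ∈ᵇ K ≡ false) → ∀ x → D K x ≡ 1ℚ
    D-no-descents K pos none = poly-rigidity (D-poly K pos) (poly-const 1ℚ) 1 agree
      where
      agree : ∀ n → 1 ≤ n → D K (ℕtoℚ n) ≡ 1ℚ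
      agree n 1≤n = trans (D-count K pos n (ℕP.<-≤-trans (s≤s (mx-lub K 0 (λ z z∈ → ⊥-elim (true≢false (trans (sym z∈) (none z)))))) 1≤n))
                          (cong ℕtoℚ (dcount-no-descents K none n))

    D-count-above : ∀ J → Positive J → ∀ k → (∀ z → z ∈ᵇ J ≡ true → z < k) → D J (ℕtoℚ k) ≡ ℕtoℚ (dcount J k)
    D-count-above J pos zero J<0 = trans (D-no-descents J pos none 0ℚ) (cong ℕtoℚ (sym (dcount-no-descents J none 0)))
      where
      none : ∀ z → z ∈ᵇ J ≡ false
      none z = not-true (λ z∈ → ℕP.n≮0 (J<0 z z∈))
    D-count-above J pos (suc k) J<k = D-count J pos (suc k) (s≤s (mx-lub J k (λ z z∈ → ℕP.≤-pred (J<k z z∈))))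

    recTermℚ : List ℕ → ℕ → (List ℕ → ℚ) → ℚ
    recTermℚ J p f = ℕtoℚ (boundary J p) * (ℕtoℚ (nonzero p) * f (shiftAt J (suc p)) + f (deleteAt J (suc p)))

    ℕtoℚ-recTerm : ∀ J p c f →
      (suc p ∈ᵇ J ≡ true → (ℕtoℚ (c (shiftAt J (suc p))) ≡ f (shiftAt J (suc p))) × (ℕtoℚ (c (deleteAt J (suc p))) ≡ f (deleteAt J (suc p)))) →
      ℕtoℚ (recTerm J p c) ≡ recTermℚ J p f
    ℕtoℚ-recTerm J p c f agree =
      ℕtoℚ-guarded ((suc p ∈ᵇ J) ∧ not (p ∈ᵇ J)) (nonzero p ℕ.* c S ℕ.+ c H) (ℕtoℚ (nonzero p) * f S + f H) body
      where
      S H : List ℕ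
      S = shiftAt J (suc p)
      H = deleteAt J (suc p)
      body : (suc p ∈ᵇ J) ∧ not (p ∈ᵇ J) ≡ true → ℕtoℚ (nonzero p ℕ.* c S ℕ.+ c H) ≡ ℕtoℚ (nonzero p) * f S + f H
      body on = trans (ℕtoℚ-+ (nonzero p ℕ.* c S) (c H))
        (cong₂ _+_ (trans (ℕtoℚ-* (nonzero p) (c S)) (cong (ℕtoℚ (nonzero p) *_) (proj₁ (agree (∧-true₁ on))))) (proj₂ (agree (∧-true₁ on))))

    -- The polynomial form of the
    -- recurrence, D J (x+1) = D J x + Σ_{p<m} recTermℚ, holds at all large
    -- naturals and hence everywhere; at x = m the sum equals the count sum,
    -- and d(J, m) = 0, so D J m = 0.
    module VanishingAtMax (y : ℕ) (L : List ℕ) (pos : Positive (y ∷ L)) where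
      J : List ℕ
      J = y ∷ L
      m : ℕ
      m = mx J

      0∉J : 0 ∈ᵇ J ≡ false
      0∉J = positive⇒0∉ J pos

      shift-pos : ∀ p → Positive (shiftAt J (suc p))
      shift-pos p = 0∉⇒positive _ (shiftAt-positive J p 0∉J)

      delete-pos : ∀ p → Positive (deleteAt J (suc p))
      delete-pos p = 0∉⇒positive _ (deleteAt-positive J p 0∉J)

      J<m+1 : ∀ z → z ∈ᵇ J ≡ true → z < suc m
      J<m+1 z z∈ = s≤s (mx-ub J z z∈)

      recurrence-rhs : ℚ → ℚ
      recurrence-rhs x = D J x + sumℚ (map (λ p → recTermℚ J p (λ X → D X x)) (upTo m))

      recurrence-rhs-poly : IsPoly recurrence-rhs
      recurrence-rhs-poly = poly-+ (D-poly J pos) (poly-sum (upTo m) (λ p x → recTermℚ J p (λ X → D X x)) (summands-poly m))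
        where
        summands-poly : ∀ k → All (λ p → IsPoly (λ x → recTermℚ J p (λ X → D X x))) (upTo k)
        summands-poly k = AllP.applyUpTo⁺₂ (λ x → x) k (λ p → poly-* (poly-const (ℕtoℚ (boundary J p)))
                       (poly-+ (poly-* (poly-const (ℕtoℚ (nonzero p))) (D-poly (shiftAt J (suc p)) (shift-pos p))) (D-poly (deleteAt J (suc p)) (delete-pos p))))

      -- At lengths k ≥ m the recurrence sum stops at m, and its terms are the
      -- polynomial values (the sets involved lie below m).
      counts-as-poly : ∀ k → m ≤ k → ℕtoℚ (∑ (upTo k) (λ p → recTerm J p (λ X → dcount X k)))
                     ≡ sumℚ (map (λ p → recTermℚ J p (λ X → D X (ℕtoℚ k))) (upTo m))
      counts-as-poly k m≤k = begin
        ℕtoℚ (∑ (upTo k) T)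
          ≡⟨ cong (λ t → ℕtoℚ (∑ (upTo t) T)) (sym (ℕP.m+[n∸m]≡n m≤k)) ⟩
        ℕtoℚ (∑ (upTo (m ℕ.+ (k ℕ.∸ m))) T)
          ≡⟨ cong ℕtoℚ (∑-upTo-trunc m (k ℕ.∸ m) T (λ p m≤p → recTerm-off J p (λ X → dcount X k) (off p m≤p))) ⟩
        ℕtoℚ (∑ (upTo m) T)
          ≡⟨ ℕtoℚ-∑ (upTo m) T ⟩
        sumℚ (map (λ p → ℕtoℚ (T p)) (upTo m))
          ≡⟨ sumℚ-cong (upTo m) (AllP.applyUpTo⁺₂ (λ x → x) m (λ p → ℕtoℚ-recTerm J p (λ X → dcount X k) (λ X → D X (ℕtoℚ k)) (at-poly p))) ⟩
        sumℚ (map (λ p → recTermℚ J p (λ X → D X (ℕtoℚ k))) (upTo m)) ∎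
        where
        T : ℕ → ℕ
        T p = recTerm J p (λ X → dcount X k)
        off : ∀ p → m ≤ p → boundary J p ≡ 0
        off p m≤p rewrite not-true {suc p ∈ᵇ J} (λ p+1∈ → ℕP.<-irrefl refl (ℕP.≤-trans (mx-ub J (suc p) p+1∈) m≤p)) = refl
        at-poly : ∀ p → suc p ∈ᵇ J ≡ true → (ℕtoℚ (dcount (shiftAt J (suc p)) k) ≡ D (shiftAt J (suc p)) (ℕtoℚ k)) × (ℕtoℚ (dcount (deleteAt J (suc p)) k) ≡ D (deleteAt J (suc p)) (ℕtoℚ k))
        at-poly p p+1∈J =
          sym (D-count-above _ (shift-pos p) k (λ z z∈ → ℕP.<-≤-trans (shiftAt-below-bound J p m J<m+1 p+1∈J z z∈) m≤k)) ,
          sym (D-count-above _ (delete-pos p) k (λ z z∈ → ℕP.<-≤-trans (deleteAt-below-bound J p m J<m+1 p+1∈J z z∈) m≤k))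

      recurrence-at : ∀ k → m ≤ k → D J (ℕtoℚ (suc k)) ≡ ℕtoℚ (dcount J k) + sumℚ (map (λ p → recTermℚ J p (λ X → D X (ℕtoℚ k))) (upTo m))
      recurrence-at k m≤k = begin
        D J (ℕtoℚ (suc k))                                   ≡⟨ D-count J pos (suc k) (s≤s m≤k) ⟩
        ℕtoℚ (dcount J (suc k))                              ≡⟨ cong ℕtoℚ (descent-recurrence J k) ⟩
        ℕtoℚ (∑ (upTo k) (λ p → recTerm J p (λ X → dcount X k)) ℕ.+ dcount J k)
                                                             ≡⟨ ℕtoℚ-+ (∑ (upTo k) (λ p → recTerm J p (λ X → dcount X k))) (dcount J k) ⟩
        ℕtoℚ (∑ (upTo k) (λ p → recTerm J p (λ X → dcount X k))) + ℕtoℚ (dcount J k)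
                                                             ≡⟨ cong₂ _+_ (counts-as-poly k m≤k) refl ⟩
        S + ℕtoℚ (dcount J k)                                ≡⟨ +-comm S (ℕtoℚ (dcount J k)) ⟩
        ℕtoℚ (dcount J k) + S                                ∎
        where
        S : ℚ
        S = sumℚ (map (λ p → recTermℚ J p (λ X → D X (ℕtoℚ k))) (upTo m))

      recurrence-poly : ∀ x → D J (x + 1ℚ) ≡ recurrence-rhs x
      recurrence-poly = poly-rigidity (poly-shift (D-poly J pos)) recurrence-rhs-poly (suc m) agree
        where
        agree : ∀ n → suc m ≤ n → D J (ℕtoℚ n + 1ℚ) ≡ recurrence-rhs (ℕtoℚ n)
        agree n m<n = trans (cong (D J) (sym (ℕtoℚ-suc n)))
          (trans (recurrence-at n (ℕP.<⇒≤ m<n)) (cong (_+ sumℚ (map (λ p → recTermℚ J p (λ X → D X (ℕtoℚ n))) (upTo m))) (sym (D-count J pos n m<n))))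

      D-vanishes-at-max : D J (ℕtoℚ m) ≡ 0ℚ
      D-vanishes-at-max = begin
        D J (ℕtoℚ m)                    ≡⟨ solve 2 (λ d S → d := (d :+ S) :- S) refl (D J (ℕtoℚ m)) S ⟩
        (D J (ℕtoℚ m) + S) - S          ≡⟨ cong (_- S) (sym (trans (cong (D J) (ℕtoℚ-suc m)) (recurrence-poly (ℕtoℚ m)))) ⟩
        D J (ℕtoℚ (suc m)) - S          ≡⟨ cong (_- S) (recurrence-at m ℕP.≤-refl) ⟩
        (ℕtoℚ (dcount J m) + S) - S     ≡⟨ cong (λ t → (ℕtoℚ t + S) - S) (dcount-too-short J m m (mx-∈ y L) ℕP.≤-refl) ⟩
        (0ℚ + S) - S                    ≡⟨ solve 1 (λ S → (con 0ℚ :+ S) :- S := con 0ℚ) refl S ⟩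
        0ℚ                              ∎
        where
        S : ℚ
        S = sumℚ (map (λ p → recTermℚ J p (λ X → D X (ℕtoℚ m))) (upTo m))

    D-vanishes-at-top : ∀ K k → Positive K → k ∈ᵇ K ≡ true → (∀ z → z ∈ᵇ K ≡ true → z ≤ k) → D K (ℕtoℚ k) ≡ 0ℚ
    D-vanishes-at-top (w ∷ L) k pos k∈K K≤k =
      subst (λ t → D (w ∷ L) (ℕtoℚ t) ≡ 0ℚ) (ℕP.≤-antisym (mx-lub (w ∷ L) k K≤k) (mx-ub (w ∷ L) k k∈K))
            (VanishingAtMax.D-vanishes-at-max w L pos)

-- At naturals n > m this is the descent recurrence regrouped by the element
-- x = p+1 ∈ I at which a run of I starts (x - 1 ∉ I): such an x ≠ m
-- contributes d(I_t, n) (when x ≠ 1) and d(Î_t, n), while x = m contributes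
-- the shuffle count of (I⁻, m-1), which is d(I⁻, m-1)·C(n, m-1).  Both sides
-- are polynomials in n, so rigidity extends the identity to all n.
module Corollary where
  open import Defs
  open NatCast
  open Polynomials
  open Binomials
  open BoolSets
  open FiniteSums
  open DescentRecurrence
  open Shuffle
  open SortedLists
  open DescentPolynomials
  open import Data.Nat as ℕ using (ℕ; zero; suc; pred; _<_; _≤_; _≡ᵇ_; _∸_)
  import Data.Nat.Properties as ℕP
  open import Data.Nat.Combinatorics using (_C_)
  import Data.Nat.Solver as ℕSolver
  open import Data.Bool using (Bool; true; false; not; _∧_; _∨_; if_then_else_)
  open import Data.List using (List; []; _∷_; [_]; _++_; map; upTo)
  import Data.List.Properties as LP
  open import Data.List.Relation.Unary.All using (All)
  import Data.List.Relation.Unary.All as All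
  open import Data.List.Relation.Unary.Linked using (Linked)
  open import Data.Product using (_,_; proj₁; proj₂; _×_)
  open import Data.Sum using (_⊎_; inj₁; inj₂)
  open import Data.Rational using (ℚ; _+_; _*_; 0ℚ; 1ℚ)
  open import Data.Rational.Properties using (*-zeroˡ)
  open import Data.Empty using (⊥-elim)
  import Data.Rational.Solver as ℚSolver
  open import Relation.Binary.PropositionalEquality hiding ([_])
  open ≡-Reasoning

  -- Regrouping the contribution of a run start x = p+1 ∈ I, x ≠ m, by the two
  -- membership tests defining I'' (x ≠ 1, x - 1 ∉ I) and I' (x - 1 ∉ I).
  regroup : ∀ u v w A B → 𝟙 (not u) ℕ.* (𝟙 (not v) ℕ.* (𝟙 (not w) ℕ.* A ℕ.+ B))
                        ≡ 𝟙 ((not w ∧ (not v ∧ true)) ∧ not u) ℕ.* A ℕ.+ 𝟙 ((not v ∧ true) ∧ not u) ℕ.* B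
  regroup u v w A B rewrite 𝟙-∧ (not w ∧ (not v ∧ true)) (not u) | 𝟙-∧ (not w) (not v ∧ true) | 𝟙-∧ (not v) true | 𝟙-∧ (not v ∧ true) (not u) | 𝟙-∧ (not v) true =
    solve 5 (λ U V W A B → U :* (V :* (W :* A :+ B)) := W :* (V :* con 1) :* U :* A :+ V :* con 1 :* U :* B) refl (𝟙 (not u)) (𝟙 (not v)) (𝟙 (not w)) A B
    where open ℕSolver.+-*-Solver using (solve; _:=_; _:+_; _:*_; con)

  𝟙-split : ∀ b k → k ≡ 𝟙 (not b) ℕ.* k ℕ.+ 𝟙 b ℕ.* k
  𝟙-split true k = sym (ℕP.+-identityʳ k)
  𝟙-split false k = sym (trans (ℕP.+-identityʳ _) (ℕP.*-identityˡ k))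

  module _ (D : List ℕ → ℚ → ℚ) (isD : IsDescentPoly D) where

    -- The top run start: for I = K ∪ {a'+1} the recurrence term at a' is
    -- D(K, a')·binom n a' (by the shuffle identity when a' ∉ K, and because
    -- D K vanishes at its maximum a' otherwise).
    binomial-term : ∀ K a' → Positive K → (K<a : ∀ z → z ∈ᵇ K ≡ true → z < suc a') → ∀ n → a' ≤ n →
      ℕtoℚ (recTerm (K ++ [ suc a' ]) a' (λ X → dcount X n)) ≡ D K (ℕtoℚ a') * binom (ℕtoℚ n) a'
    binomial-term K a' pos K<a n a'≤n = trans (cong ℕtoℚ (AppendTop.top-term K a' K<a n)) guarded
      where
      guarded : ℕtoℚ (𝟙 (not (a' ∈ᵇ K)) ℕ.* shuffleCount K a' n) ≡ D K (ℕtoℚ a') * binom (ℕtoℚ n) a'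
      guarded with a' ∈ᵇ K in a'∈K
      ... | true = sym (trans (cong (_* binom (ℕtoℚ n) a') (D-vanishes-at-top D isD K a' pos a'∈K (λ z z∈ → ℕP.≤-pred (K<a z z∈))))
                              (*-zeroˡ (binom (ℕtoℚ n) a')))
      ... | false = begin
        ℕtoℚ (shuffleCount K a' n ℕ.+ 0)        ≡⟨ cong ℕtoℚ (trans (ℕP.+-identityʳ _) (shuffle-identity-≥ a' K n (positive⇒0∉ K pos) K<a' a'≤n)) ⟩
        ℕtoℚ (dcount K a' ℕ.* (n C a'))          ≡⟨ ℕtoℚ-* (dcount K a') (n C a') ⟩
        ℕtoℚ (dcount K a') * ℕtoℚ (n C a')       ≡⟨ cong₂ _*_ (sym (D-count-above D isD K pos a' K<a')) (sym (binom-nat n a')) ⟩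
        D K (ℕtoℚ a') * binom (ℕtoℚ n) a'        ∎
        where
        K<a' : ∀ z → z ∈ᵇ K ≡ true → z < a'
        K<a' = bound-tighten K a' K<a a'∈K

    module Main (y : ℕ) (L : List ℕ) (sorted : Linked _<_ (y ∷ L)) (pos : Positive (y ∷ L)) where
      I : List ℕ
      I = y ∷ L

      m a' : ℕ
      m = mx I
      a' = m ∸ 1

      0∉I : 0 ∈ᵇ I ≡ false
      0∉I = positive⇒0∉ I pos

      m≡suc-a' : m ≡ suc a'
      m≡suc-a' = suc-∸1 m (ℕP.<-≤-trans (All-elim I pos y (∈-here y [] L)) (mx-ub I y (∈-here y [] L)))
        where
        suc-∸1 : ∀ k → 0 < k → k ≡ suc (k ∸ 1)
        suc-∸1 (suc k) _ = refl

      I⁻ : List ℕ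
      I⁻ = initL I

      I≡I⁻++[m] : I ≡ I⁻ ++ [ suc a' ]
      I≡I⁻++[m] = trans (init-last y L) (cong (λ t → I⁻ ++ [ t ]) (trans (sym (mx≡last y L sorted)) m≡suc-a'))

      I⁻<m : ∀ z → z ∈ᵇ I⁻ ≡ true → z < suc a'
      I⁻<m = linked-prefix< I⁻ (subst (Linked _<_) I≡I⁻++[m] sorted)

      I⁻-positive : Positive I⁻
      I⁻-positive = All-intro I⁻ (λ z z∈ → All-elim I pos z
        (subst (λ X → z ∈ᵇ X ≡ true) (sym I≡I⁻++[m]) (trans (∈ᵇ-++ z I⁻ [ suc a' ]) (cong (_∨ (z ∈ᵇ [ suc a' ])) z∈))))

      members-≤m : ∀ X p → (∀ z → z ∈ᵇ X ≡ true → ((z ∈ᵇ I ≡ true) × (z ≤ p)) ⊎ (suc z ∈ᵇ I ≡ true)) → mx X ≤ m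
      members-≤m X p members = mx-lub X m bound
        where
        bound : ∀ z → z ∈ᵇ X ≡ true → z ≤ m
        bound z z∈ with members z z∈
        ... | inj₁ (z∈I , _) = mx-ub I z z∈I
        ... | inj₂ z+1∈I = ℕP.<⇒≤ (mx-ub I (suc z) z+1∈I)

      module AtElement (e : ℕ × ℕ) (at : IsIndexOf I e) where
        open AtIndex I sorted 0∉I (proj₁ e) (proj₂ e) at public using (p; x≡suc-p; Ist≈shiftAt; Ihat≈deleteAt)

        Ist-positive : Positive (Ist I (proj₁ e))
        Ist-positive = 0∉⇒positive (Ist I (proj₁ e)) (trans (Ist≈shiftAt 0) (subst (λ t → 0 ∈ᵇ shiftAt I t ≡ false) (sym x≡suc-p) (shiftAt-positive I p 0∉I)))

        Ihat-positive : Positive (Ihat I (proj₁ e))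
        Ihat-positive = 0∉⇒positive (Ihat I (proj₁ e)) (trans (Ihat≈deleteAt 0) (subst (λ t → 0 ∈ᵇ deleteAt I t ≡ false) (sym x≡suc-p) (deleteAt-positive I p 0∉I)))

        Ist-bound : mx (Ist I (proj₁ e)) ≤ m
        Ist-bound = members-≤m (Ist I (proj₁ e)) p (λ z z∈ → shiftAt-members I p z (subst (λ t → z ∈ᵇ shiftAt I t ≡ true) x≡suc-p (trans (sym (Ist≈shiftAt z)) z∈)))

        Ihat-bound : mx (Ihat I (proj₁ e)) ≤ m
        Ihat-bound = members-≤m (Ihat I (proj₁ e)) p (λ z z∈ → deleteAt-members I p z (subst (λ t → z ∈ᵇ deleteAt I t ≡ true) x≡suc-p (trans (sym (Ihat≈deleteAt z)) z∈)))

      IstTerm IhatTerm : ℚ → ℕ × ℕ → ℚ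
      IstTerm q e = if (proj₂ e ∈ᵇ Idprime I) ∧ not (proj₂ e ≡ᵇ m) then D (Ist I (proj₁ e)) q else 0ℚ
      IhatTerm q e = if (proj₂ e ∈ᵇ Iprime I) ∧ not (proj₂ e ≡ᵇ m) then D (Ihat I (proj₁ e)) q else 0ℚ

      rhs : ℚ → ℚ
      rhs q = D I q + sumℚ (map (IstTerm q) (enum I)) + sumℚ (map (IhatTerm q) (enum I)) + D I⁻ (ℕtoℚ a') * binom q a'

      rhs-poly : IsPoly rhs
      rhs-poly = poly-+ (poly-+ (poly-+ (D-poly D isD I pos)
          (poly-sum (enum I) (λ e q → IstTerm q e) (All.map (λ {e} at → poly-if _ (D-poly D isD (Ist I (proj₁ e)) (AtElement.Ist-positive e at))) (enum-indices I))))
          (poly-sum (enum I) (λ e q → IhatTerm q e) (All.map (λ {e} at → poly-if _ (D-poly D isD (Ihat I (proj₁ e)) (AtElement.Ihat-positive e at))) (enum-indices I))))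
        (poly-* (poly-const (D I⁻ (ℕtoℚ a'))) (poly-binom a'))

      runStart : ℕ → ℕ → ℕ
      runStart n x = 𝟙 (not (pred x ∈ᵇ I)) ℕ.* (nonzero (pred x) ℕ.* dcount (shiftAt I x) n ℕ.+ dcount (deleteAt I x) n)

      recTerm≡runStart : ∀ n p → recTerm I p (λ X → dcount X n) ≡ 𝟙 (suc p ∈ᵇ I) ℕ.* runStart n (suc p)
      recTerm≡runStart n p = trans (cong (ℕ._* R) (𝟙-∧ (suc p ∈ᵇ I) (not (p ∈ᵇ I)))) (ℕP.*-assoc (𝟙 (suc p ∈ᵇ I)) (𝟙 (not (p ∈ᵇ I))) R)
        where
        R : ℕ
        R = nonzero p ℕ.* dcount (shiftAt I (suc p)) n ℕ.+ dcount (deleteAt I (suc p)) n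

      IstCount IhatCount : ℕ → ℕ → ℕ
      IstCount n x = 𝟙 ((x ∈ᵇ Idprime I) ∧ not (x ≡ᵇ m)) ℕ.* dcount (shiftAt I x) n
      IhatCount n x = 𝟙 ((x ∈ᵇ Iprime I) ∧ not (x ≡ᵇ m)) ℕ.* dcount (deleteAt I x) n

      split-run-start : ∀ n x → x ∈ᵇ I ≡ true → 𝟙 (not (x ≡ᵇ m)) ℕ.* runStart n x ≡ IstCount n x ℕ.+ IhatCount n x
      split-run-start n zero x∈ = ⊥-elim (true≢false (trans (sym x∈) 0∉I))
      split-run-start n (suc x') x∈ rewrite ∈-filter (λ x → not (x ≡ᵇ 1)) (Iprime I) (suc x') | ∈-filter (λ x → not ((x ∸ 1) ∈ᵇ I)) I (suc x') | x∈ =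
        regroup (suc x' ≡ᵇ m) (x' ∈ᵇ I) (x' ≡ᵇ 0) (dcount (shiftAt I (suc x')) n) (dcount (deleteAt I (suc x')) n)

      recurrence-by-elements : ∀ n → m < n → ∑ (upTo n) (λ p → recTerm I p (λ X → dcount X n))
                             ≡ (∑ I (IstCount n) ℕ.+ ∑ I (IhatCount n)) ℕ.+ runStart n m
      recurrence-by-elements n m<n = begin
        ∑ (upTo n) (λ p → recTerm I p (λ X → dcount X n))
          ≡⟨ ∑-cong (upTo n) (recTerm≡runStart n) ⟩
        ∑ (upTo n) (λ p → 𝟙 (suc p ∈ᵇ I) ℕ.* runStart n (suc p))
          ≡⟨ ∑-positions n I sorted 0∉I (λ z z∈ → ℕP.<⇒≤ (ℕP.≤-<-trans (mx-ub I z z∈) m<n)) (runStart n) ⟩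
        ∑ I (runStart n)
          ≡⟨ trans (∑-cong I (λ x → 𝟙-split (x ≡ᵇ m) (runStart n x))) (∑-+ I (λ x → 𝟙 (not (x ≡ᵇ m)) ℕ.* runStart n x) (λ x → 𝟙 (x ≡ᵇ m) ℕ.* runStart n x)) ⟩
        ∑ I (λ x → 𝟙 (not (x ≡ᵇ m)) ℕ.* runStart n x) ℕ.+ ∑ I (λ x → 𝟙 (x ≡ᵇ m) ℕ.* runStart n x)
          ≡⟨ cong₂ ℕ._+_ (trans (∑-cong-∈ I (split-run-start n)) (∑-+ I (IstCount n) (IhatCount n))) (∑-delta-∈ I m (runStart n) sorted (mx-∈ y L)) ⟩
        (∑ I (IstCount n) ℕ.+ ∑ I (IhatCount n)) ℕ.+ runStart n m ∎

      enum-sum : ∀ n (test : ℕ → Bool) (byValue byIndex : ℕ → List ℕ) →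
        (∀ e → IsIndexOf I e → ℕtoℚ (dcount (byValue (proj₂ e)) n) ≡ D (byIndex (proj₁ e)) (ℕtoℚ n)) →
        ℕtoℚ (∑ I (λ x → 𝟙 (test x) ℕ.* dcount (byValue x) n))
          ≡ sumℚ (map (λ e → if test (proj₂ e) then D (byIndex (proj₁ e)) (ℕtoℚ n) else 0ℚ) (enum I))
      enum-sum n test byValue byIndex agree = begin
        ℕtoℚ (∑ I (λ x → 𝟙 (test x) ℕ.* dcount (byValue x) n))
          ≡⟨ ℕtoℚ-∑ I (λ x → 𝟙 (test x) ℕ.* dcount (byValue x) n) ⟩
        sumℚ (map (λ x → ℕtoℚ (𝟙 (test x) ℕ.* dcount (byValue x) n)) I)
          ≡⟨ sumℚ-cong I (All.universal (λ x → ℕtoℚ-𝟙 (test x) (dcount (byValue x) n)) I) ⟩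
        sumℚ (map g I)
          ≡⟨ cong (λ X → sumℚ (map g X)) (sym (proj₂-enum I)) ⟩
        sumℚ (map g (map proj₂ (enum I)))
          ≡⟨ cong sumℚ (sym (LP.map-∘ {g = g} {f = proj₂} (enum I))) ⟩
        sumℚ (map (λ e → g (proj₂ e)) (enum I))
          ≡⟨ sumℚ-cong (enum I) (All.map (λ {e} at → cong (λ t → if test (proj₂ e) then t else 0ℚ) (agree e at)) (enum-indices I)) ⟩
        sumℚ (map (λ e → if test (proj₂ e) then D (byIndex (proj₁ e)) (ℕtoℚ n) else 0ℚ) (enum I)) ∎
        where
        g : ℕ → ℚ
        g x = if test x then ℕtoℚ (dcount (byValue x) n) else 0ℚ

      Ist-sum : ∀ n → m < n → ℕtoℚ (∑ I (IstCount n)) ≡ sumℚ (map (IstTerm (ℕtoℚ n)) (enum I))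
      Ist-sum n m<n = enum-sum n (λ x → (x ∈ᵇ Idprime I) ∧ not (x ≡ᵇ m)) (shiftAt I) (Ist I) agree
        where
        agree : ∀ e → IsIndexOf I e → ℕtoℚ (dcount (shiftAt I (proj₂ e)) n) ≡ D (Ist I (proj₁ e)) (ℕtoℚ n)
        agree e at = sym (trans (D-count D isD (Ist I (proj₁ e)) Ist-positive n (ℕP.≤-<-trans Ist-bound m<n))
                                (cong ℕtoℚ (dcount-resp (Ist I (proj₁ e)) (shiftAt I (proj₂ e)) Ist≈shiftAt n)))
          where open AtElement e at

      Ihat-sum : ∀ n → m < n → ℕtoℚ (∑ I (IhatCount n)) ≡ sumℚ (map (IhatTerm (ℕtoℚ n)) (enum I))
      Ihat-sum n m<n = enum-sum n (λ x → (x ∈ᵇ Iprime I) ∧ not (x ≡ᵇ m)) (deleteAt I) (Ihat I) agree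
        where
        agree : ∀ e → IsIndexOf I e → ℕtoℚ (dcount (deleteAt I (proj₂ e)) n) ≡ D (Ihat I (proj₁ e)) (ℕtoℚ n)
        agree e at = sym (trans (D-count D isD (Ihat I (proj₁ e)) Ihat-positive n (ℕP.≤-<-trans Ihat-bound m<n))
                                (cong ℕtoℚ (dcount-resp (Ihat I (proj₁ e)) (deleteAt I (proj₂ e)) Ihat≈deleteAt n)))
          where open AtElement e at

      top-sum : ∀ n → m < n → ℕtoℚ (runStart n m) ≡ D I⁻ (ℕtoℚ a') * binom (ℕtoℚ n) a'
      top-sum n m<n = begin
        ℕtoℚ (runStart n m)
          ≡⟨ cong (λ t → ℕtoℚ (runStart n t)) m≡suc-a' ⟩
        ℕtoℚ (runStart n (suc a'))
          ≡⟨ cong ℕtoℚ (sym (trans (recTerm≡runStart n a') (trans (cong (λ b → 𝟙 b ℕ.* runStart n (suc a')) m∈I) (ℕP.+-identityʳ _)))) ⟩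
        ℕtoℚ (recTerm I a' (λ X → dcount X n))
          ≡⟨ cong (λ X → ℕtoℚ (recTerm X a' (λ X → dcount X n))) I≡I⁻++[m] ⟩
        ℕtoℚ (recTerm (I⁻ ++ [ suc a' ]) a' (λ X → dcount X n))
          ≡⟨ binomial-term I⁻ a' I⁻-positive I⁻<m n (ℕP.≤-trans (ℕP.n≤1+n a') (ℕP.<⇒≤ (subst (_< n) m≡suc-a' m<n))) ⟩
        D I⁻ (ℕtoℚ a') * binom (ℕtoℚ n) a' ∎
        where
        m∈I : suc a' ∈ᵇ I ≡ true
        m∈I = subst (λ t → t ∈ᵇ I ≡ true) m≡suc-a' (mx-∈ y L)

      rhs-at-naturals : ∀ n → suc m ≤ n → D I (ℕtoℚ n + 1ℚ) ≡ rhs (ℕtoℚ n)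
      rhs-at-naturals n m<n = begin
        D I (ℕtoℚ n + 1ℚ)
          ≡⟨ trans (cong (D I) (sym (ℕtoℚ-suc n))) (D-count D isD I pos (suc n) (ℕP.m<n⇒m<1+n m<n)) ⟩
        ℕtoℚ (dcount I (suc n))
          ≡⟨ cong ℕtoℚ (trans (descent-recurrence I n) (cong (ℕ._+ dcount I n) (recurrence-by-elements n m<n))) ⟩
        ℕtoℚ (((∑ I (IstCount n) ℕ.+ ∑ I (IhatCount n)) ℕ.+ runStart n m) ℕ.+ dcount I n)
          ≡⟨ cast-sum4 (∑ I (IstCount n)) (∑ I (IhatCount n)) (runStart n m) (dcount I n) ⟩
        ((ℕtoℚ (∑ I (IstCount n)) + ℕtoℚ (∑ I (IhatCount n))) + ℕtoℚ (runStart n m)) + ℕtoℚ (dcount I n)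
          ≡⟨ cong₂ _+_ (cong₂ _+_ (cong₂ _+_ (Ist-sum n m<n) (Ihat-sum n m<n)) (top-sum n m<n)) (sym (D-count D isD I pos n m<n)) ⟩
        ((Σ₁ + Σ₂) + T) + D I (ℕtoℚ n)
          ≡⟨ solve 4 (λ a b c d → ((a :+ b) :+ c) :+ d := d :+ a :+ b :+ c) refl Σ₁ Σ₂ T (D I (ℕtoℚ n)) ⟩
        rhs (ℕtoℚ n) ∎
        where
        open ℚSolver.+-*-Solver using (solve; _:=_; _:+_)
        Σ₁ Σ₂ T : ℚ
        Σ₁ = sumℚ (map (IstTerm (ℕtoℚ n)) (enum I))
        Σ₂ = sumℚ (map (IhatTerm (ℕtoℚ n)) (enum I))
        T = D I⁻ (ℕtoℚ a') * binom (ℕtoℚ n) a'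
        cast-sum4 : ∀ a b c d → ℕtoℚ (((a ℕ.+ b) ℕ.+ c) ℕ.+ d) ≡ ((ℕtoℚ a + ℕtoℚ b) + ℕtoℚ c) + ℕtoℚ d
        cast-sum4 a b c d = trans (ℕtoℚ-+ ((a ℕ.+ b) ℕ.+ c) d) (cong (_+ ℕtoℚ d) (trans (ℕtoℚ-+ (a ℕ.+ b) c) (cong (_+ ℕtoℚ c) (ℕtoℚ-+ a b))))

      corollary : ∀ q → D I (q + 1ℚ) ≡ rhs q
      corollary = poly-rigidity (poly-shift (D-poly D isD I pos)) rhs-poly (suc m) rhs-at-naturals

open import Defs
open import Data.Nat using (ℕ; _<_; _∸_; _≡ᵇ_)
open import Data.Bool using (not; _∧_; if_then_else_)
open import Data.List using (List; []; _∷_; map)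
open import Data.List.Relation.Unary.All using (All)
open import Data.List.Relation.Unary.Linked using (Linked)
open import Data.Product using (_,_)
open import Data.Rational using (ℚ; _+_; _*_; 0ℚ; 1ℚ)
open import Relation.Binary.PropositionalEquality using (_≡_; _≢_; refl)
open import Data.Empty using (⊥-elim)

corollary2p2 : (D : List ℕ → ℚ → ℚ) → IsDescentPoly D →
    (I : List ℕ) → I ≢ [] → Linked _<_ I → All (λ i → 0 < i) I →
    (n : ℚ) →
    D I (n + 1ℚ) ≡
      D I n
      + sumℚ (map (λ { (s , x) → if (x ∈ᵇ Idprime I) ∧ not (x ≡ᵇ mx I) then D (Ist I s) n else 0ℚ }) (enum I))
      + sumℚ (map (λ { (s , x) → if (x ∈ᵇ Iprime I) ∧ not (x ≡ᵇ mx I) then D (Ihat I s) n else 0ℚ }) (enum I))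
      + D (initL I) (ℕtoℚ (mx I ∸ 1)) * binom n (mx I ∸ 1)
-- I is nonempty; the pattern lambdas of the statement are, by eta for pairs,
-- the functions IstTerm and IhatTerm of Corollary.Main.
corollary2p2 D isD [] I≢[] sorted positive n = ⊥-elim (I≢[] refl)
corollary2p2 D isD (y ∷ L) I≢[] sorted positive n = Corollary.Main.corollary D isD y L sorted positive n
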